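{- Consider the priority assignment that sets, for each item $x\in[n]$, $\mathrm{pri}_x:=-\lfloor \log_2 (1/\mathbf{p}_x)\rfloor+\delta_x$ with $\delta_x\sim U(0,1)$ independent, where $\mathbf{p}$ is a probability distribution on $[n]$ (items with $\mathbf{p}_x=0$ receive priority $-\infty$, i.e. lower than all others), and let $T$ be the resulting Treap. There exists a distribution $\mathbf{p}$ on $[n]$ such that $\mathbb{E}_{x\sim\mathbf{p}}[\mathrm{depth}(x)]=\Omega(\log^2 n)$.
   Context: A Treap with distinct priorities is the unique binary search tree on the ordered keys $[n]$ in which every node's priority is at least the priorities of its descendants. $\mathrm{depth}(x)$ is the number of ancestors of $x$ in $T$ (including $x$). The expectation is over both $x\sim\mathbf{p}$ and the random offsets. -}

module Defs where

open import Data.Bool using (Bool; true; false; if_then_else_; _∧_; not)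
open import Data.Nat as ℕ using (ℕ; zero; suc; _∸_; _<ᵇ_; _≡ᵇ_)
open import Data.Nat.Logarithm using (⌊log₂_⌋)
open import Data.Integer as ℤ using (ℤ; +_)
open import Data.Fin using (Fin; toℕ)
open import Data.List using (List; []; _∷_; concatMap; length; map; allFin)
open import Data.Rational as ℚ using (ℚ; 0ℚ; _+_; _*_; ↥_; ↧ₙ_; _/_)
open import Relation.Binary.PropositionalEquality using (_≡_)
open import Data.Product using (_×_; _,_)

sumℚ : {A : Set} → List A → (A → ℚ) → ℚ
sumℚ []       f = 0ℚ
sumℚ (a ∷ as) f = f a + sumℚ as f

ℕtoℚ : ℕ → ℚ
ℕtoℚ k = + k / 1

record Distribution (n : ℕ) : Set where
  field
    prob    : Fin n → ℚ
    nonneg  : ∀ x → 0ℚ ℚ.≤ prob x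
    sumsTo1 : sumℚ (allFin n) prob ≡ ℚ.1ℚ
open Distribution public

-- Integer part of the priority: for p_x > 0, level x = ⌊log₂ (1/p_x)⌋,
-- so pri_x = - level x + δ_x.  For p = a/b with 0 < a ≤ b we use
-- ⌊log₂ (b/a)⌋ = ⌊log₂ ⌊b/a⌋⌋.

isZeroℚ : ℚ → Bool
isZeroℚ q = ℤ.∣ ↥ q ∣ ≡ᵇ 0

level : ℚ → ℕ
level q = ⌊log₂ (ℕ._/_ (↧ₙ q) (suc (ℤ.∣ ↥ q ∣ ∸ 1))) ⌋

-- The offsets δ_x ~ U(0,1) i.i.d. matter only through their relative
-- order, which is a uniformly random permutation of [n] (ties have
-- probability 0).  A permutation is represented as a list of all items;
-- an item earlier in the list has larger offset δ.

inserts : {A : Set} → A → List A → List (List A)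
inserts a []       = (a ∷ []) ∷ []
inserts a (b ∷ bs) = (a ∷ b ∷ bs) ∷ map (b ∷_) (inserts a bs)

perms : {A : Set} → List A → List (List A)
perms []       = [] ∷ []
perms (a ∷ as) = concatMap (inserts a) (perms as)

eqFin : {n : ℕ} → Fin n → Fin n → Bool
eqFin x y = toℕ x ≡ᵇ toℕ y

before : {n : ℕ} → List (Fin n) → Fin n → Fin n → Bool
before []       x y = false
before (z ∷ zs) x y = if eqFin z x then not (eqFin z y)
                      else (if eqFin z y then false else before zs x y)

-- beats p σ x y : item x has strictly higher priority than item y,
-- where pri_x = -level(p_x) + δ_x, items with p_x = 0 have priority -∞
-- (ties among those are broken by δ as well; irrelevant for the result).
beats : {n : ℕ} → (Fin n → ℚ) → List (Fin n) → Fin n → Fin n → Bool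
beats p σ x y with isZeroℚ (p x) | isZeroℚ (p y)
... | true  | true  = before σ x y
... | true  | false = false
... | false | true  = true
... | false | false =
  if level (p x) <ᵇ level (p y) then true
  else (if level (p y) <ᵇ level (p x) then false else before σ x y)

-- Treap construction: the root of the keys (in increasing order) is the
-- item of maximum priority; left/right subtrees are built recursively
-- from the keys before/after it.  (Fuel ≥ number of keys suffices.)

data Tree (A : Set) : Set where
  leaf : Tree A
  node : Tree A → A → Tree A → Tree A

maxBy : {A : Set} → (A → A → Bool) → A → List A → A
maxBy b m []       = m
maxBy b m (z ∷ zs) = maxBy b (if b z m then z else m) zs

splitKeys : {n : ℕ} → Fin n → List (Fin n) → List (Fin n) × List (Fin n)
splitKeys m [] = [] , []
splitKeys m (z ∷ zs) with eqFin z m | splitKeys m zs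
... | true  | _       = [] , zs
... | false | (l , r) = (z ∷ l) , r

buildFuel : {n : ℕ} → (Fin n → Fin n → Bool) → ℕ → List (Fin n) → Tree (Fin n)
buildFuel b zero    ks       = leaf
buildFuel b (suc f) []       = leaf
buildFuel b (suc f) (k ∷ ks) with maxBy b k ks
... | m with splitKeys m (k ∷ ks)
...   | (l , r) = node (buildFuel b f l) m (buildFuel b f r)

treap : (n : ℕ) → (Fin n → ℚ) → List (Fin n) → Tree (Fin n)
treap n p σ = buildFuel (beats p σ) n (allFin n)

depth : {n : ℕ} → Tree (Fin n) → Fin n → ℕ
depth leaf         x = 0
depth (node l m r) x =
  if eqFin x m then 1
  else (if toℕ x <ᵇ toℕ m then suc (depth l x) else suc (depth r x))

-- Σ_σ Σ_x p_x · depth_σ(x), summed over all n! offset orders σ.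
-- The expectation E_{x∼p, δ}[depth(x)] equals this divided by n!.
totalWeightedDepth : (n : ℕ) → Distribution n → ℚ
totalWeightedDepth n D =
  sumℚ (perms (allFin n)) λ σ →
    sumℚ (allFin n) λ x → prob D x * ℕtoℚ (depth (treap n (prob D) σ) x)

numOrders : ℕ → ℕ
numOrders n = length (perms (allFin n))

{-# OPTIONS --safe #-}

-- Give half of the mass to B = 2^(3G+1) keys at the left end, all with the smallest integer part of the
-- priority, and follow them by G segments of 2^G keys each, the integer part increasing from segment to
-- segment and constant within a segment.  A segment key is then an ancestor of every one of the B keys
-- as soon as its offset beats the offsets of the keys preceding it in its own segment, which for the
-- j-th key of a segment happens with probability 1/(j+1).  These probabilities add up to at least G/2
-- per segment, so each of the B keys has expected depth at least G²/2 and E[depth] ≥ G²/4, where G is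
-- about (log₂ n)/3.

module Submission where

module TreapDepth where

  open import Defs
  open import Data.Bool using (Bool; true; false; if_then_else_; _∧_; _∨_; not; T)
  open import Data.Bool.ListAction using (all)
  open import Data.Bool.Properties using (∧-zeroʳ; ∧-identityʳ)
  open import Data.Empty using (⊥-elim)
  open import Data.Fin as Fin using (Fin; toℕ; zero; suc)
  open import Data.Fin.Properties as Fin using (toℕ-injective)
  open import Data.Integer as ℤ using (ℤ)
  import Data.Integer.Properties as ℤᴾ
  open import Data.Integer.Tactic.RingSolver renaming (solve-∀ to ℤ-solve-∀)
  open import Data.List using (List; []; _∷_; _++_; map; concat; concatMap; length; tabulate; allFin; filterᵇ)
  open import Data.List.Membership.Propositional using (_∈_)
  open import Data.List.Membership.Propositional.Properties using (∈-insert; ∈-filter⁺; ∈-allFin)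
  open import Data.List.Properties using (length-tabulate; length-++)
  open import Data.List.Relation.Binary.Permutation.Propositional as ↭ using (_↭_; ↭-refl; ↭-sym; ↭-trans; ↭-prep; ↭-reflexive)
  open import Data.List.Relation.Binary.Permutation.Propositional.Properties using (shift; ++⁺ˡ; ++-comm; ↭-length)
  open import Data.List.Relation.Unary.All as All using (All; []; _∷_)
  open import Data.List.Relation.Unary.All.Properties as All using (map⁺; concat⁺)
  open import Data.List.Relation.Unary.AllPairs using (AllPairs; []; _∷_)
  import Data.List.Relation.Unary.AllPairs.Properties as AllPairs
  open import Data.List.Relation.Unary.Any using (here; there)
  open import Data.Nat as ℕ using (ℕ; zero; suc; _+_; _*_; _∸_; _^_; _≤_; _<_; _!; _≡ᵇ_; _<ᵇ_; _≤ᵇ_; z≤n; s≤s; z<s; s<s; NonZero; ⌊_/2⌋; ⌈_/2⌉)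
  open import Data.Nat.Coprimality using (1-coprimeTo)
  open import Data.Nat.DivMod using (_/_; _%_; n/1≡n; m*n/n≡m; m/n*n≤m; /-monoˡ-≤; m<n*o⇒m/o<n; m≥n⇒m/n>0; m≡m%n+[m/n]*n; m%n<n)
  open import Data.Nat.Induction using (<-rec)
  open import Data.Nat.Logarithm using (⌊log₂_⌋; ⌊log₂[2^n]⌋≡n; ⌊log₂⌋-mono-≤; ⌊log₂⌊n/2⌋⌋≡⌊log₂n⌋∸1)
  open import Data.Nat.Properties
  open import Data.Nat.Tactic.RingSolver using (solve-∀)
  open import Data.Product using (_×_; _,_; proj₁; proj₂)
  open import Data.Rational as ℚ using (ℚ; 0ℚ; 1ℚ; mkℚ+; toℚᵘ)
  import Data.Rational.Properties as ℚᴾ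
  import Data.Rational.Unnormalised as ℚᵘ
  import Data.Rational.Unnormalised.Properties as ℚᵘᴾ
  open import Data.Sum using (_⊎_; inj₁; inj₂)
  open import Function using (_∘_)
  open import Relation.Binary.Definitions using (Tri; tri<; tri≈; tri>)
  open import Relation.Binary.PropositionalEquality
  open import Relation.Nullary using (¬_; T?; Dec; yes; no; does; _×-dec_; _⊎-dec_; _→-dec_)
  open import Relation.Nullary.Reflects using (Reflects; ofʸ; ofⁿ; det; fromEquivalence)

  𝟙 : Bool → ℕ
  𝟙 true  = 1
  𝟙 false = 0

  𝟙≤1 : ∀ b → 𝟙 b ≤ 1
  𝟙≤1 true  = ≤-refl
  𝟙≤1 false = z≤n

  𝟙-does-mono : ∀ {P Q : Set} (P? : Dec P) (Q? : Dec Q) → (P → Q) → 𝟙 (does P?) ≤ 𝟙 (does Q?)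
  𝟙-does-mono (no _)  _       _   = z≤n
  𝟙-does-mono (yes _) (yes _) _   = ≤-refl
  𝟙-does-mono (yes p) (no ¬q) p→q = ⊥-elim (¬q (p→q p))

  𝟙-does-yes : ∀ {P : Set} (P? : Dec P) → P → 𝟙 (does P?) ≡ 1
  𝟙-does-yes (yes _) _ = refl
  𝟙-does-yes (no ¬p) p = ⊥-elim (¬p p)

  𝟙-does-no : ∀ {P : Set} (P? : Dec P) → ¬ P → 𝟙 (does P?) ≡ 0
  𝟙-does-no (yes p) ¬p = ⊥-elim (¬p p)
  𝟙-does-no (no _)  _  = refl

  module _ {p} {P : Set p} {b : Bool} (r : Reflects P b) where

    reflects-yes : P → b ≡ true
    reflects-yes p = det r (ofʸ p)

    reflects-no : ¬ P → b ≡ false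
    reflects-no ¬p = det r (ofⁿ ¬p)

    reflects-T : P → T b
    reflects-T p = subst T (sym (reflects-yes p)) _

  ≡ᵇ-reflects-≡ : ∀ m n → Reflects (m ≡ n) (m ≡ᵇ n)
  ≡ᵇ-reflects-≡ m n = fromEquivalence (≡ᵇ⇒≡ m n) (≡⇒≡ᵇ m n)

  eqFin-reflects : ∀ {n} (x y : Fin n) → Reflects (x ≡ y) (eqFin x y)
  eqFin-reflects x y = fromEquivalence (toℕ-injective ∘ ≡ᵇ⇒≡ (toℕ x) (toℕ y)) (≡⇒≡ᵇ (toℕ x) (toℕ y) ∘ cong toℕ)

  eqFin-refl : ∀ {n} (x : Fin n) → eqFin x x ≡ true
  eqFin-refl x = reflects-yes (eqFin-reflects x x) refl

  <ᵇ-irrefl : ∀ m → (m <ᵇ m) ≡ false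
  <ᵇ-irrefl m = reflects-no (<ᵇ-reflects-< m m) (<-irrefl refl)

  sumℕ : {A : Set} → List A → (A → ℕ) → ℕ
  sumℕ []       f = 0
  sumℕ (a ∷ as) f = f a + sumℕ as f

  module _ {A : Set} where

    sumℕ-++ : ∀ (xs ys : List A) f → sumℕ (xs ++ ys) f ≡ sumℕ xs f + sumℕ ys f
    sumℕ-++ []       ys f = refl
    sumℕ-++ (x ∷ xs) ys f = trans (cong (f x +_) (sumℕ-++ xs ys f)) (sym (+-assoc (f x) _ _))

    sumℕ-cong : ∀ (xs : List A) {f g : A → ℕ} → (∀ a → f a ≡ g a) → sumℕ xs f ≡ sumℕ xs g
    sumℕ-cong []       e = refl
    sumℕ-cong (x ∷ xs) e = cong₂ _+_ (e x) (sumℕ-cong xs e)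

    sumℕ-cong-All : ∀ {xs : List A} {f g : A → ℕ} → All (λ a → f a ≡ g a) xs → sumℕ xs f ≡ sumℕ xs g
    sumℕ-cong-All []       = refl
    sumℕ-cong-All (e ∷ es) = cong₂ _+_ e (sumℕ-cong-All es)

    sumℕ-mono : ∀ (xs : List A) {f g : A → ℕ} → (∀ a → f a ≤ g a) → sumℕ xs f ≤ sumℕ xs g
    sumℕ-mono []       le = z≤n
    sumℕ-mono (x ∷ xs) le = +-mono-≤ (le x) (sumℕ-mono xs le)

    sumℕ-zero : ∀ {xs : List A} {f : A → ℕ} → All (λ a → f a ≡ 0) xs → sumℕ xs f ≡ 0
    sumℕ-zero []       = refl
    sumℕ-zero (e ∷ es) = cong₂ _+_ e (sumℕ-zero es)

    sumℕ-const : ∀ (xs : List A) c → sumℕ xs (λ _ → c) ≡ length xs * c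
    sumℕ-const []       c = refl
    sumℕ-const (x ∷ xs) c = cong (c +_) (sumℕ-const xs c)

    sumℕ-+ : ∀ (xs : List A) f g → sumℕ xs (λ a → f a + g a) ≡ sumℕ xs f + sumℕ xs g
    sumℕ-+ []       f g = refl
    sumℕ-+ (x ∷ xs) f g = trans (cong (f x + g x +_) (sumℕ-+ xs f g)) (+-interchange (f x) (g x) _ _)
      where
      +-interchange : ∀ a b c d → a + b + (c + d) ≡ a + c + (b + d)
      +-interchange = solve-∀

    sumℕ-*ˡ : ∀ (xs : List A) c f → sumℕ xs (λ a → c * f a) ≡ c * sumℕ xs f
    sumℕ-*ˡ []       c f = sym (*-zeroʳ c)
    sumℕ-*ˡ (x ∷ xs) c f = trans (cong (c * f x +_) (sumℕ-*ˡ xs c f)) (sym (*-distribˡ-+ c (f x) _))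

    length-filterᵇ : ∀ (p : A → Bool) xs → length (filterᵇ p xs) ≡ sumℕ xs (𝟙 ∘ p)
    length-filterᵇ p []       = refl
    length-filterᵇ p (x ∷ xs) with p x
    ... | true  = cong suc (length-filterᵇ p xs)
    ... | false = length-filterᵇ p xs

  module _ {A B : Set} where

    sumℕ-map : ∀ (g : A → B) xs f → sumℕ (map g xs) f ≡ sumℕ xs (f ∘ g)
    sumℕ-map g []       f = refl
    sumℕ-map g (x ∷ xs) f = cong (f (g x) +_) (sumℕ-map g xs f)

    sumℕ-concatMap : ∀ (g : A → List B) xs f → sumℕ (concatMap g xs) f ≡ sumℕ xs (λ a → sumℕ (g a) f)
    sumℕ-concatMap g []       f = refl
    sumℕ-concatMap g (x ∷ xs) f =
      trans (sumℕ-++ (g x) (concat (map g xs)) f) (cong (sumℕ (g x) f +_) (sumℕ-concatMap g xs f))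

    sumℕ-comm : ∀ (xs : List A) (ys : List B) (f : A → B → ℕ) →
      sumℕ xs (λ a → sumℕ ys (f a)) ≡ sumℕ ys (λ b → sumℕ xs (λ a → f a b))
    sumℕ-comm []       ys f = sym (trans (sumℕ-const ys 0) (*-zeroʳ (length ys)))
    sumℕ-comm (x ∷ xs) ys f =
      trans (cong (sumℕ ys (f x) +_) (sumℕ-comm xs ys f)) (sym (sumℕ-+ ys (f x) _))

  sumBelow : ℕ → (ℕ → ℕ) → ℕ
  sumBelow zero    g = 0
  sumBelow (suc n) g = g 0 + sumBelow n (g ∘ suc)

  sumBelow-+ : ∀ a b g → sumBelow (a + b) g ≡ sumBelow a g + sumBelow b (λ i → g (a + i))
  sumBelow-+ zero    b g = refl
  sumBelow-+ (suc a) b g = trans (cong (g 0 +_) (sumBelow-+ a b (g ∘ suc))) (sym (+-assoc (g 0) _ _))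

  sumBelow-cong : ∀ n {f g : ℕ → ℕ} → (∀ i → i < n → f i ≡ g i) → sumBelow n f ≡ sumBelow n g
  sumBelow-cong zero    e = refl
  sumBelow-cong (suc n) e = cong₂ _+_ (e 0 z<s) (sumBelow-cong n (λ i i<n → e (suc i) (s<s i<n)))

  sumBelow-mono : ∀ n {f g : ℕ → ℕ} → (∀ i → i < n → f i ≤ g i) → sumBelow n f ≤ sumBelow n g
  sumBelow-mono zero    le = z≤n
  sumBelow-mono (suc n) le = +-mono-≤ (le 0 z<s) (sumBelow-mono n (λ i i<n → le (suc i) (s<s i<n)))

  sumBelow-const : ∀ n c → sumBelow n (λ _ → c) ≡ n * c
  sumBelow-const zero    c = refl
  sumBelow-const (suc n) c = cong (c +_) (sumBelow-const n c)

  sumBelow-*ˡ : ∀ n c g → sumBelow n (λ i → c * g i) ≡ c * sumBelow n g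
  sumBelow-*ˡ zero    c g = sym (*-zeroʳ c)
  sumBelow-*ˡ (suc n) c g = trans (cong (c * g 0 +_) (sumBelow-*ˡ n c (g ∘ suc))) (sym (*-distribˡ-+ c (g 0) _))

  sumBelow-zero : ∀ n {g : ℕ → ℕ} → (∀ i → i < n → g i ≡ 0) → sumBelow n g ≡ 0
  sumBelow-zero n e = trans (sumBelow-cong n e) (trans (sumBelow-const n 0) (*-zeroʳ n))

  sumBelow-window : ∀ lo k n g → lo + k ≤ n → sumBelow k (λ i → g (lo + i)) ≤ sumBelow n g
  sumBelow-window lo k n g lo+k≤n = begin
    sumBelow k (λ i → g (lo + i))                             ≤⟨ m≤n+m _ (sumBelow lo g) ⟩
    sumBelow lo g + sumBelow k (λ i → g (lo + i))             ≡⟨ sumBelow-+ lo k g ⟨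
    sumBelow (lo + k) g                                       ≤⟨ m≤m+n _ _ ⟩
    sumBelow (lo + k) g + sumBelow (n ∸ (lo + k)) (λ i → g (lo + k + i)) ≡⟨ sumBelow-+ (lo + k) _ g ⟨
    sumBelow (lo + k + (n ∸ (lo + k))) g                      ≡⟨ cong (λ m → sumBelow m g) (m+[n∸m]≡n lo+k≤n) ⟩
    sumBelow n g                                              ∎
    where open ≤-Reasoning

  sumBelow-blocks : ∀ G S g → sumBelow (G * S) g ≡ sumBelow G (λ k → sumBelow S (λ j → g (k * S + j)))
  sumBelow-blocks zero    S g = refl
  sumBelow-blocks (suc G) S g =
    trans (sumBelow-+ S (G * S) g)
      (cong (sumBelow S g +_) (trans (sumBelow-blocks G S (λ i → g (S + i)))
        (sumBelow-cong G (λ k _ → sumBelow-cong S (λ j _ → cong g (sym (+-assoc S (k * S) j)))))))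

  inRangeᵇ : ℕ → ℕ → ℕ → Bool
  inRangeᵇ lo hi i = (lo ≤ᵇ i) ∧ (i <ᵇ hi)

  inRangeᵇ-reflects : ∀ lo hi i → Reflects (lo ≤ i × i < hi) (inRangeᵇ lo hi i)
  inRangeᵇ-reflects lo hi i with lo ≤ᵇ i | ≤ᵇ-reflects-≤ lo i | i <ᵇ hi | <ᵇ-reflects-< i hi
  ... | true  | ofʸ lo≤i | true  | ofʸ i<hi = ofʸ (lo≤i , i<hi)
  ... | true  | ofʸ _    | false | ofⁿ i≮hi = ofⁿ (i≮hi ∘ proj₂)
  ... | false | ofⁿ lo≰i | _     | _        = ofⁿ (lo≰i ∘ proj₁)

  sumBelow-inRange : ∀ n lo hi → lo ≤ hi → hi ≤ n → sumBelow n (𝟙 ∘ inRangeᵇ lo hi) ≡ hi ∸ lo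
  sumBelow-inRange n lo hi lo≤hi hi≤n = begin
    sumBelow n g
      ≡⟨ cong (λ m → sumBelow m g) n≡ ⟨
    sumBelow (lo + (k + r)) g
      ≡⟨ sumBelow-+ lo (k + r) g ⟩
    sumBelow lo g + sumBelow (k + r) (λ i → g (lo + i))
      ≡⟨ cong₂ _+_ (sumBelow-zero lo below) (sumBelow-+ k r (λ i → g (lo + i))) ⟩
    0 + (sumBelow k (λ i → g (lo + i)) + sumBelow r (λ i → g (lo + (k + i))))
      ≡⟨ cong₂ (λ a b → a + b) (sumBelow-cong k inside) (sumBelow-zero r above) ⟩
    sumBelow k (λ _ → 1) + 0
      ≡⟨ trans (+-identityʳ _) (trans (sumBelow-const k 1) (*-identityʳ k)) ⟩
    k ∎
    where
    open ≡-Reasoning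
    g = 𝟙 ∘ inRangeᵇ lo hi
    k = hi ∸ lo
    r = n ∸ hi
    lo+k≡hi : lo + k ≡ hi
    lo+k≡hi = m+[n∸m]≡n lo≤hi
    n≡ : lo + (k + r) ≡ n
    n≡ = trans (sym (+-assoc lo k r)) (trans (cong (_+ r) lo+k≡hi) (m+[n∸m]≡n hi≤n))
    below : ∀ i → i < lo → g i ≡ 0
    below i i<lo = cong 𝟙 (reflects-no (inRangeᵇ-reflects lo hi i) (λ (lo≤i , _) → <⇒≱ i<lo lo≤i))
    inside : ∀ i → i < k → g (lo + i) ≡ 1
    inside i i<k = cong 𝟙 (reflects-yes (inRangeᵇ-reflects lo hi (lo + i))
      (m≤m+n lo i , subst (lo + i <_) lo+k≡hi (+-monoʳ-< lo i<k)))
    above : ∀ i → i < r → g (lo + (k + i)) ≡ 0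
    above i _ = cong 𝟙 (reflects-no (inRangeᵇ-reflects lo hi (lo + (k + i)))
      (λ (_ , lt) → <⇒≱ lt (subst (_≤ lo + (k + i)) lo+k≡hi (subst (lo + k ≤_) (+-assoc lo k i) (m≤m+n (lo + k) i)))))

  -- Each of the top 2^t terms is at least N / 2^(t+1), so the top half of the range contributes N / 2.
  sumBelow-harmonic : ∀ t N (c : ℕ → ℕ) → (∀ j → j < 2 ^ t → N ≤ c j * suc j) → t * N ≤ 2 * sumBelow (2 ^ t) c
  sumBelow-harmonic zero    N c h = z≤n
  sumBelow-harmonic (suc t) N c h = begin
    N + t * N
      ≤⟨ +-mono-≤ upperHalf (sumBelow-harmonic t N c (λ j j<2^t → h j (<-≤-trans j<2^t 2^t≤2^[1+t]))) ⟩
    2 * upper + 2 * lower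
      ≡⟨ trans (+-comm (2 * upper) _) (sym (*-distribˡ-+ 2 lower upper)) ⟩
    2 * (lower + upper)
      ≡⟨ cong (2 *_) (sumBelow-+ (2 ^ t) (2 ^ t) c) ⟨
    2 * sumBelow (2 ^ t + 2 ^ t) c
      ≡⟨ cong (λ m → 2 * sumBelow m c) 2^[1+t]≡ ⟨
    2 * sumBelow (2 ^ suc t) c ∎
    where
    open ≤-Reasoning
    instance
      2^t≢0 : NonZero (2 ^ t)
      2^t≢0 = m^n≢0 2 t
    lower = sumBelow (2 ^ t) c
    upper = sumBelow (2 ^ t) (λ j → c (2 ^ t + j))
    2^[1+t]≡ : 2 ^ suc t ≡ 2 ^ t + 2 ^ t
    2^[1+t]≡ = cong (2 ^ t +_) (+-identityʳ (2 ^ t))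
    2^t≤2^[1+t] : 2 ^ t ≤ 2 ^ suc t
    2^t≤2^[1+t] = subst (2 ^ t ≤_) (sym 2^[1+t]≡) (m≤m+n _ _)
    upperTerm : ∀ j → j < 2 ^ t → N ≤ c (2 ^ t + j) * 2 ^ suc t
    upperTerm j j<2^t = ≤-trans (h (2 ^ t + j) (subst (2 ^ t + j <_) (sym 2^[1+t]≡) (+-monoʳ-< (2 ^ t) j<2^t)))
      (*-monoʳ-≤ (c (2 ^ t + j)) (subst (suc (2 ^ t + j) ≤_) (sym 2^[1+t]≡)
        (subst (_≤ 2 ^ t + 2 ^ t) (+-suc (2 ^ t) j) (+-monoʳ-≤ (2 ^ t) j<2^t))))
    upperHalf : N ≤ 2 * upper
    upperHalf = *-cancelˡ-≤ (2 ^ t) (begin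
      2 ^ t * N                                         ≡⟨ sumBelow-const (2 ^ t) N ⟨
      sumBelow (2 ^ t) (λ _ → N)                        ≤⟨ sumBelow-mono (2 ^ t) upperTerm ⟩
      sumBelow (2 ^ t) (λ j → c (2 ^ t + j) * 2 ^ suc t) ≡⟨ sumBelow-cong (2 ^ t) (λ j _ → *-comm (c (2 ^ t + j)) _) ⟩
      sumBelow (2 ^ t) (λ j → 2 ^ suc t * c (2 ^ t + j)) ≡⟨ sumBelow-*ˡ (2 ^ t) (2 ^ suc t) _ ⟩
      2 ^ suc t * upper                                 ≡⟨ cong (_* upper) (*-comm 2 (2 ^ t)) ⟩
      2 ^ t * 2 * upper                                 ≡⟨ *-assoc (2 ^ t) 2 upper ⟩
      2 ^ t * (2 * upper)                               ∎)

  extend : ∀ {n} → (Fin n → ℕ) → ℕ → ℕ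
  extend {zero}  F i       = 0
  extend {suc n} F zero    = F zero
  extend {suc n} F (suc i) = extend (F ∘ suc) i

  sumℕ-tabulate : ∀ {A : Set} k (h : Fin k → A) (F : A → ℕ) → sumℕ (tabulate h) F ≡ sumBelow k (extend (F ∘ h))
  sumℕ-tabulate zero    h F = refl
  sumℕ-tabulate (suc k) h F = cong (F (h zero) +_) (sumℕ-tabulate k (h ∘ suc) F)

  sumℕ-allFin : ∀ n (F : Fin n → ℕ) → sumℕ (allFin n) F ≡ sumBelow n (extend F)
  sumℕ-allFin n F = sumℕ-tabulate n (λ x → x) F

  extend-toℕ : ∀ n (g : ℕ → ℕ) i → i < n → extend (g ∘ toℕ {n}) i ≡ g i
  extend-toℕ (suc n) g zero    _       = refl
  extend-toℕ (suc n) g (suc i) (s<s i<n) = extend-toℕ n (g ∘ suc) i i<n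

  sumℕ-allFin-toℕ : ∀ n (g : ℕ → ℕ) → sumℕ (allFin n) (g ∘ toℕ) ≡ sumBelow n g
  sumℕ-allFin-toℕ n g = trans (sumℕ-allFin n (g ∘ toℕ)) (sumBelow-cong n (extend-toℕ n g))

  extend-fromℕ< : ∀ {n} (F : Fin n → ℕ) {i} (i<n : i < n) → extend F i ≡ F (Fin.fromℕ< i<n)
  extend-fromℕ< {suc n} F {zero}  _         = refl
  extend-fromℕ< {suc n} F {suc i} (s<s i<n) = extend-fromℕ< (F ∘ suc) i<n

  -- Sums over all orderings of a list

  module _ {A : Set} where

    private
      sumInserts² : A → A → List A → (List A → ℕ) → ℕ
      sumInserts² x y τ f = sumℕ (inserts y τ) (λ ρ → sumℕ (inserts x ρ) f)

      sumℕ-inserts-∷ : ∀ x t ρ (f : List A → ℕ) →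
        sumℕ (inserts x (t ∷ ρ)) f ≡ f (x ∷ t ∷ ρ) + sumℕ (inserts x ρ) (f ∘ (t ∷_))
      sumℕ-inserts-∷ x t ρ f = cong (f (x ∷ t ∷ ρ) +_) (sumℕ-map (t ∷_) (inserts x ρ) f)

      sumInserts²-∷ : ∀ x y t τ f → sumInserts² x y (t ∷ τ) f ≡
        f (x ∷ y ∷ t ∷ τ) + f (y ∷ x ∷ t ∷ τ) + sumℕ (inserts x τ) (λ σ → f (y ∷ t ∷ σ))
          + sumℕ (inserts y τ) (λ ρ → f (x ∷ t ∷ ρ)) + sumInserts² x y τ (f ∘ (t ∷_))
      sumInserts²-∷ x y t τ f = begin
        sumInserts² x y (t ∷ τ) f
          ≡⟨ cong (sumℕ (inserts x (y ∷ t ∷ τ)) f +_) (sumℕ-map (t ∷_) (inserts y τ) _) ⟩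
        sumℕ (inserts x (y ∷ t ∷ τ)) f + sumℕ (inserts y τ) (λ ρ → sumℕ (inserts x (t ∷ ρ)) f)
          ≡⟨ cong₂ _+_
               (trans (sumℕ-inserts-∷ x y (t ∷ τ) f) (cong (f (x ∷ y ∷ t ∷ τ) +_) (sumℕ-inserts-∷ x t τ (f ∘ (y ∷_)))))
               (trans (sumℕ-cong (inserts y τ) (λ ρ → sumℕ-inserts-∷ x t ρ f)) (sumℕ-+ (inserts y τ) _ _)) ⟩
        a + (b + c) + (d + e)
          ≡⟨ reassoc a b c d e ⟩
        a + b + c + d + e ∎
        where
        open ≡-Reasoning
        a = f (x ∷ y ∷ t ∷ τ)
        b = f (y ∷ x ∷ t ∷ τ)
        c = sumℕ (inserts x τ) (λ σ → f (y ∷ t ∷ σ))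
        d = sumℕ (inserts y τ) (λ ρ → f (x ∷ t ∷ ρ))
        e = sumInserts² x y τ (f ∘ (t ∷_))
        reassoc : ∀ a b c d e → a + (b + c) + (d + e) ≡ a + b + c + d + e
        reassoc = solve-∀

      sumInserts²-comm : ∀ x y τ f → sumInserts² x y τ f ≡ sumInserts² y x τ f
      sumInserts²-comm x y []      f = swap₂ (f (x ∷ y ∷ [])) (f (y ∷ x ∷ []))
        where
        swap₂ : ∀ a b → a + (b + 0) + 0 ≡ b + (a + 0) + 0
        swap₂ = solve-∀
      sumInserts²-comm x y (t ∷ τ) f = begin
        sumInserts² x y (t ∷ τ) f
          ≡⟨ sumInserts²-∷ x y t τ f ⟩
        f (x ∷ y ∷ t ∷ τ) + f (y ∷ x ∷ t ∷ τ) + sumℕ (inserts x τ) (λ σ → f (y ∷ t ∷ σ))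
          + sumℕ (inserts y τ) (λ ρ → f (x ∷ t ∷ ρ)) + sumInserts² x y τ (f ∘ (t ∷_))
          ≡⟨ cong₂ _+_ (swap₄ (f (x ∷ y ∷ t ∷ τ)) (f (y ∷ x ∷ t ∷ τ)) _ _) (sumInserts²-comm x y τ (f ∘ (t ∷_))) ⟩
        f (y ∷ x ∷ t ∷ τ) + f (x ∷ y ∷ t ∷ τ) + sumℕ (inserts y τ) (λ ρ → f (x ∷ t ∷ ρ))
          + sumℕ (inserts x τ) (λ σ → f (y ∷ t ∷ σ)) + sumInserts² y x τ (f ∘ (t ∷_))
          ≡⟨ sumInserts²-∷ y x t τ f ⟨
        sumInserts² y x (t ∷ τ) f ∎
        where
        open ≡-Reasoning
        swap₄ : ∀ a b c d → a + b + c + d ≡ b + a + d + c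
        swap₄ = solve-∀

    sumℕ-perms-↭ : ∀ {as bs : List A} → as ↭ bs → ∀ f → sumℕ (perms as) f ≡ sumℕ (perms bs) f
    sumℕ-perms-↭ ↭.refl f = refl
    sumℕ-perms-↭ {x ∷ as} {x ∷ bs} (↭.prep x p) f = begin
      sumℕ (perms (x ∷ as)) f                    ≡⟨ sumℕ-concatMap (inserts x) (perms as) f ⟩
      sumℕ (perms as) (λ τ → sumℕ (inserts x τ) f) ≡⟨ sumℕ-perms-↭ p _ ⟩
      sumℕ (perms bs) (λ τ → sumℕ (inserts x τ) f) ≡⟨ sumℕ-concatMap (inserts x) (perms bs) f ⟨
      sumℕ (perms (x ∷ bs)) f                    ∎
      where open ≡-Reasoning
    sumℕ-perms-↭ {x ∷ y ∷ as} {y ∷ x ∷ bs} (↭.swap x y p) f = begin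
      sumℕ (perms (x ∷ y ∷ as)) f                    ≡⟨ sumℕ-concatMap (inserts x) (perms (y ∷ as)) f ⟩
      sumℕ (perms (y ∷ as)) (λ ρ → sumℕ (inserts x ρ) f) ≡⟨ sumℕ-concatMap (inserts y) (perms as) _ ⟩
      sumℕ (perms as) (λ τ → sumInserts² x y τ f)      ≡⟨ sumℕ-perms-↭ p _ ⟩
      sumℕ (perms bs) (λ τ → sumInserts² x y τ f)      ≡⟨ sumℕ-cong (perms bs) (λ τ → sumInserts²-comm x y τ f) ⟩
      sumℕ (perms bs) (λ τ → sumInserts² y x τ f)      ≡⟨ sumℕ-concatMap (inserts x) (perms bs) _ ⟨
      sumℕ (perms (x ∷ bs)) (λ ρ → sumℕ (inserts y ρ) f) ≡⟨ sumℕ-concatMap (inserts y) (perms (x ∷ bs)) f ⟨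
      sumℕ (perms (y ∷ x ∷ bs)) f                    ∎
      where open ≡-Reasoning
    sumℕ-perms-↭ (↭.trans p q) f = trans (sumℕ-perms-↭ p f) (sumℕ-perms-↭ q f)

    All-length-inserts : ∀ (r : A) τ → All (λ σ → length σ ≡ suc (length τ)) (inserts r τ)
    All-length-inserts r []       = refl ∷ []
    All-length-inserts r (b ∷ bs) = refl ∷ map⁺ (All.map (cong suc) (All-length-inserts r bs))

    All-length-perms : ∀ (as : List A) → All (λ τ → length τ ≡ length as) (perms as)
    All-length-perms []       = refl ∷ []
    All-length-perms (a ∷ as) = concat⁺ (map⁺ (All.map
      (λ {τ} τ≡ → All.map (λ σ≡ → trans σ≡ (cong suc τ≡)) (All-length-inserts a τ)) (All-length-perms as)))

    InsertionInvariant : A → (List A → ℕ) → Set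
    InsertionInvariant r g = ∀ pre post → g (pre ++ r ∷ post) ≡ g (pre ++ post)

    sumℕ-inserts : ∀ r τ g → InsertionInvariant r g → sumℕ (inserts r τ) g ≡ suc (length τ) * g τ
    sumℕ-inserts r []       g inv = cong (_+ 0) (inv [] [])
    sumℕ-inserts r (b ∷ bs) g inv = cong₂ _+_ (inv [] (b ∷ bs))
      (trans (sumℕ-map (b ∷_) (inserts r bs) g) (sumℕ-inserts r bs (g ∘ (b ∷_)) (λ pre → inv (b ∷ pre))))

    sumℕ-perms-∷ : ∀ r rs g → InsertionInvariant r g → sumℕ (perms (r ∷ rs)) g ≡ suc (length rs) * sumℕ (perms rs) g
    sumℕ-perms-∷ r rs g inv = begin
      sumℕ (perms (r ∷ rs)) g                        ≡⟨ sumℕ-concatMap (inserts r) (perms rs) g ⟩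
      sumℕ (perms rs) (λ τ → sumℕ (inserts r τ) g)   ≡⟨ sumℕ-cong-All (All.map (λ {τ} τ≡ →
                                                          trans (sumℕ-inserts r τ g inv) (cong (λ k → suc k * g τ) τ≡))
                                                          (All-length-perms rs)) ⟩
      sumℕ (perms rs) (λ τ → suc (length rs) * g τ)  ≡⟨ sumℕ-*ˡ (perms rs) (suc (length rs)) g ⟩
      suc (length rs) * sumℕ (perms rs) g            ∎
      where open ≡-Reasoning

    length-perms : ∀ (as : List A) → length (perms as) ≡ length as !
    length-perms []       = refl
    length-perms (a ∷ as) = begin
      length (perms (a ∷ as))                   ≡⟨ trans (sumℕ-const (perms (a ∷ as)) 1) (*-identityʳ _) ⟨
      sumℕ (perms (a ∷ as)) (λ _ → 1)           ≡⟨ sumℕ-perms-∷ a as (λ _ → 1) (λ _ _ → refl) ⟩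
      suc (length as) * sumℕ (perms as) (λ _ → 1) ≡⟨ cong (suc (length as) *_) (trans (sumℕ-const (perms as) 1) (*-identityʳ _)) ⟩
      suc (length as) * length (perms as)       ≡⟨ cong (suc (length as) *_) (length-perms as) ⟩
      suc (length as) * length as !             ∎
      where open ≡-Reasoning

    ↭-partition : ∀ (p : A → Bool) xs → xs ↭ filterᵇ p xs ++ filterᵇ (not ∘ p) xs
    ↭-partition p []       = ↭-refl
    ↭-partition p (x ∷ xs) with p x
    ... | true  = ↭-prep x (↭-partition p xs)
    ... | false = ↭-trans (↭-prep x (↭-partition p xs)) (↭-sym (shift x (filterᵇ p xs) _))

    filterᵇ-cong : ∀ {p q : A → Bool} xs → (∀ a → p a ≡ q a) → filterᵇ p xs ≡ filterᵇ q xs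
    filterᵇ-cong         []       e = refl
    filterᵇ-cong {p} {q} (x ∷ xs) e with p x | q x | e x
    ... | true  | .true  | refl = cong (x ∷_) (filterᵇ-cong xs e)
    ... | false | .false | refl = filterᵇ-cong xs e

    filterᵇ-filterᵇ : ∀ (p q : A → Bool) xs → filterᵇ p (filterᵇ q xs) ≡ filterᵇ (λ a → q a ∧ p a) xs
    filterᵇ-filterᵇ p q []       = refl
    filterᵇ-filterᵇ p q (x ∷ xs) with q x
    ... | false = filterᵇ-filterᵇ p q xs
    ... | true with p x
    ...   | true  = cong (x ∷_) (filterᵇ-filterᵇ p q xs)
    ...   | false = filterᵇ-filterᵇ p q xs

  -- Relative order in a random ordering

  module _ {n : ℕ} where

    before-irrefl : ∀ (σ : List (Fin n)) x → before σ x x ≡ false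
    before-irrefl []      x = refl
    before-irrefl (w ∷ σ) x with eqFin w x
    ... | true  = refl
    ... | false = before-irrefl σ x

    before-trans : ∀ (σ : List (Fin n)) x y z → before σ x y ≡ true → before σ y z ≡ true → before σ x z ≡ true
    before-trans (w ∷ σ) x y z x<y y<z with eqFin w x | eqFin w y | eqFin w z
    ... | true  | false | false = refl
    ... | false | false | false = before-trans σ x y z x<y y<z
    before-trans (w ∷ σ) x y z ()  y<z | true  | true  | _
    before-trans (w ∷ σ) x y z x<y ()  | true  | false | true
    before-trans (w ∷ σ) x y z ()  y<z | false | true  | _
    before-trans (w ∷ σ) x y z x<y ()  | false | false | true

    before-insert : ∀ {r y t : Fin n} → r ≢ y → r ≢ t → ∀ pre post →
      before (pre ++ r ∷ post) y t ≡ before (pre ++ post) y t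
    before-insert {r} {y} {t} r≢y r≢t [] post
      rewrite reflects-no (eqFin-reflects r y) r≢y | reflects-no (eqFin-reflects r t) r≢t = refl
    before-insert r≢y r≢t (z ∷ pre) post rewrite before-insert r≢y r≢t pre post = refl

    before-head : ∀ {y t : Fin n} τ → y ≢ t → before (y ∷ τ) y t ≡ true
    before-head {y} {t} τ y≢t rewrite eqFin-refl y | reflects-no (eqFin-reflects y t) y≢t = refl

    precedesAll : List (Fin n) → Fin n → List (Fin n) → Bool
    precedesAll σ y ts = all (before σ y) ts

    precedesAll-insert : ∀ {r y : Fin n} {ts} → r ≢ y → All (r ≢_) ts → ∀ pre post →
      precedesAll (pre ++ r ∷ post) y ts ≡ precedesAll (pre ++ post) y ts
    precedesAll-insert r≢y []            pre post = refl
    precedesAll-insert r≢y (r≢t ∷ r≢ts) pre post =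
      cong₂ _∧_ (before-insert r≢y r≢t pre post) (precedesAll-insert r≢y r≢ts pre post)

    precedesAll-head : ∀ {y : Fin n} {ts} τ → All (y ≢_) ts → precedesAll (y ∷ τ) y ts ≡ true
    precedesAll-head τ []            = refl
    precedesAll-head τ (y≢t ∷ y≢ts) = cong₂ _∧_ (before-head τ y≢t) (precedesAll-head τ y≢ts)

    -- The orderings of y ∷ ts that start with y already make up a 1/(|ts|+1) fraction; the
    -- elements of rest, inserted afterwards, do not affect the event.
    precedesAll-count : ∀ (y : Fin n) ts rest → All (_≢ y) rest → All (λ r → All (r ≢_) ts) rest → All (y ≢_) ts →
      length (rest ++ y ∷ ts) ! ≤ sumℕ (perms (rest ++ y ∷ ts)) (λ σ → 𝟙 (precedesAll σ y ts)) * suc (length ts)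
    precedesAll-count y ts [] _ _ y≢ts = begin
      suc (length ts) * length ts !
        ≡⟨ *-comm (suc (length ts)) _ ⟩
      length ts ! * suc (length ts)
        ≡⟨ cong (_* suc (length ts)) (trans (sym (length-perms ts)) (trans (sym (*-identityʳ _)) (sym (sumℕ-const (perms ts) 1)))) ⟩
      sumℕ (perms ts) (λ _ → 1) * suc (length ts)
        ≡⟨ cong (_* suc (length ts)) (sumℕ-cong (perms ts) (λ τ → cong 𝟙 (sym (precedesAll-head τ y≢ts)))) ⟩
      sumℕ (perms ts) (λ τ → 𝟙 (precedesAll (y ∷ τ) y ts)) * suc (length ts)
        ≤⟨ *-monoˡ-≤ (suc (length ts)) (sumℕ-mono (perms ts) (λ τ → head≤inserts τ)) ⟩
      sumℕ (perms ts) (λ τ → sumℕ (inserts y τ) g) * suc (length ts)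
        ≡⟨ cong (_* suc (length ts)) (sumℕ-concatMap (inserts y) (perms ts) g) ⟨
      sumℕ (perms (y ∷ ts)) g * suc (length ts) ∎
      where
      open ≤-Reasoning
      g = λ σ → 𝟙 (precedesAll σ y ts)
      head≤inserts : ∀ τ → g (y ∷ τ) ≤ sumℕ (inserts y τ) g
      head≤inserts []      = m≤m+n _ _
      head≤inserts (_ ∷ _) = m≤m+n _ _
    precedesAll-count y ts (r ∷ rest) (r≢y ∷ rest≢y) (r≢ts ∷ rest≢ts) y≢ts = begin
      suc L * L !
        ≤⟨ *-monoʳ-≤ (suc L) (precedesAll-count y ts rest rest≢y rest≢ts y≢ts) ⟩
      suc L * (S * suc (length ts))
        ≡⟨ *-assoc (suc L) S _ ⟨
      suc L * S * suc (length ts)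
        ≡⟨ cong (_* suc (length ts)) (sumℕ-perms-∷ r (rest ++ y ∷ ts) g
             (λ pre post → cong 𝟙 (precedesAll-insert r≢y r≢ts pre post))) ⟨
      sumℕ (perms (r ∷ rest ++ y ∷ ts)) g * suc (length ts) ∎
      where
      open ≤-Reasoning
      g = λ σ → 𝟙 (precedesAll σ y ts)
      L = length (rest ++ y ∷ ts)
      S = sumℕ (perms (rest ++ y ∷ ts)) g

  filterᵇ-tabulate-none : ∀ {A : Set} {k} (h : Fin k → A) (p : A → Bool) → (∀ i → p (h i) ≡ false) →
    filterᵇ p (tabulate h) ≡ []
  filterᵇ-tabulate-none {k = zero}  h p none = refl
  filterᵇ-tabulate-none {k = suc k} h p none rewrite none zero = filterᵇ-tabulate-none (h ∘ suc) p (none ∘ suc)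

  filterᵇ-tabulate-single : ∀ {A : Set} {k} (h : Fin k → A) (p : A → Bool) y → (∀ i → p (h i) ≡ eqFin i y) →
    filterᵇ p (tabulate h) ≡ h y ∷ []
  filterᵇ-tabulate-single h p zero    single rewrite single zero =
    cong (h zero ∷_) (filterᵇ-tabulate-none (h ∘ suc) p (single ∘ suc))
  filterᵇ-tabulate-single h p (suc y) single rewrite single zero = filterᵇ-tabulate-single (h ∘ suc) p y (single ∘ suc)

  module _ {n : ℕ} (y : Fin n) (p : Fin n → Bool) (py≡false : p y ≡ false) where

    private
      isY aroundY : Fin n → Bool
      isY z     = eqFin z y
      aroundY z = isY z ∨ p z

    allFin-↭-around : allFin n ↭ filterᵇ (not ∘ aroundY) (allFin n) ++ y ∷ filterᵇ p (allFin n)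
    allFin-↭-around = begin
      allFin n                                  ↭⟨ ↭-partition aroundY (allFin n) ⟩
      filterᵇ aroundY xs ++ filterᵇ (not ∘ aroundY) xs ↭⟨ ++-comm (filterᵇ aroundY xs) _ ⟩
      filterᵇ (not ∘ aroundY) xs ++ filterᵇ aroundY xs ↭⟨ ++⁺ˡ (filterᵇ (not ∘ aroundY) xs) split ⟩
      filterᵇ (not ∘ aroundY) xs ++ y ∷ filterᵇ p xs ∎
      where
      open ↭.PermutationReasoning
      xs = allFin n
      onlyY : ∀ z → (aroundY z ∧ isY z) ≡ isY z
      onlyY z with isY z
      ... | true  = refl
      ... | false = ∧-zeroʳ (p z)
      exceptY : ∀ z → (aroundY z ∧ not (isY z)) ≡ p z
      exceptY z with isY z | eqFin-reflects z y
      ... | false | _        = ∧-identityʳ (p z)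
      ... | true  | ofʸ refl = sym py≡false
      split : filterᵇ aroundY xs ↭ y ∷ filterᵇ p xs
      split = ↭-trans (↭-partition isY (filterᵇ aroundY xs)) (↭-reflexive (cong₂ _++_
        (trans (filterᵇ-filterᵇ isY aroundY xs)
          (trans (filterᵇ-cong xs onlyY) (filterᵇ-tabulate-single (λ z → z) isY y (λ _ → refl))))
        (trans (filterᵇ-filterᵇ (not ∘ isY) aroundY xs) (filterᵇ-cong xs exceptY))))

    precedesAll-count-allFin : n ! ≤ sumℕ (perms (allFin n)) (λ σ → 𝟙 (precedesAll σ y (filterᵇ p (allFin n))))
                                     * suc (length (filterᵇ p (allFin n)))
    precedesAll-count-allFin = begin
      n !                                   ≡⟨ cong _! length≡n ⟨
      length (rest ++ y ∷ ts) !             ≤⟨ precedesAll-count y ts rest rest≢y rest≢ts y≢ts ⟩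
      sumℕ (perms (rest ++ y ∷ ts)) g * suc (length ts) ≡⟨ cong (_* suc (length ts)) (sumℕ-perms-↭ allFin-↭-around g) ⟨
      sumℕ (perms (allFin n)) g * suc (length ts) ∎
      where
      open ≤-Reasoning
      ts = filterᵇ p (allFin n)
      rest = filterᵇ (not ∘ aroundY) (allFin n)
      inTs : All (T ∘ p) ts
      inTs = All.all-filter (T? ∘ p) (allFin n)
      inRest : All (T ∘ not ∘ aroundY) rest
      inRest = All.all-filter (T? ∘ not ∘ aroundY) (allFin n)
      not-p : ∀ {z} → p z ≡ false → ¬ T (p z)
      not-p pz≡false t rewrite pz≡false = t
      outside : ∀ {z} → T (not (aroundY z)) → z ≢ y × p z ≡ false
      outside {z} t with isY z | eqFin-reflects z y | p z
      ... | false | ofⁿ z≢y | false = z≢y , refl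
      rest≢y : All (_≢ y) rest
      rest≢y = All.map (proj₁ ∘ outside) inRest
      rest≢ts : All (λ r → All (r ≢_) ts) rest
      rest≢ts = All.map (λ r∈ → All.map (λ pt r≡t → not-p (proj₂ (outside r∈)) (subst (T ∘ p) (sym r≡t) pt)) inTs) inRest
      y≢ts : All (y ≢_) ts
      y≢ts = All.map (λ pt y≡t → not-p py≡false (subst (T ∘ p) (sym y≡t) pt)) inTs
      length≡n : length (rest ++ y ∷ ts) ≡ n
      length≡n = trans (sym (↭-length allFin-↭-around)) (length-tabulate {n = n} (λ z → z))
      g : List (Fin n) → ℕ
      g σ = 𝟙 (precedesAll σ y ts)

  -- Ancestors in a treap

  module _ {n : ℕ} where

    depth-node-≡ : ∀ (l r : Tree (Fin n)) m → depth (node l m r) m ≡ 1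
    depth-node-≡ l r m rewrite eqFin-refl m = refl

    depth-node-< : ∀ (l r : Tree (Fin n)) {m x} → x Fin.< m → depth (node l m r) x ≡ suc (depth l x)
    depth-node-< l r {m} {x} x<m
      rewrite reflects-no (eqFin-reflects x m) (Fin.<⇒≢ x<m) | reflects-yes (<ᵇ-reflects-< (toℕ x) (toℕ m)) x<m = refl

    depth-node-> : ∀ (l r : Tree (Fin n)) {m x} → m Fin.< x → depth (node l m r) x ≡ suc (depth r x)
    depth-node-> l r {m} {x} m<x
      rewrite reflects-no (eqFin-reflects x m) (≢-sym (Fin.<⇒≢ m<x))
            | reflects-no (<ᵇ-reflects-< (toℕ x) (toℕ m)) (<⇒≯ m<x) = refl

    Between : Fin n → Fin n → Fin n → Set
    Between x z y = (x Fin.≤ z × z Fin.≤ y) ⊎ (y Fin.≤ z × z Fin.≤ x)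

    between? : ∀ x z y → Dec (Between x z y)
    between? x z y = (x Fin.≤? z ×-dec z Fin.≤? y) ⊎-dec (y Fin.≤? z ×-dec z Fin.≤? x)

  AllPairs-split : ∀ {A : Set} {R : A → A → Set} l m r → AllPairs R (l ++ m ∷ r) →
    AllPairs R l × AllPairs R r × All (λ z → R z m) l × All (R m) r
  AllPairs-split []      m r (m<r ∷ sr) = [] , sr , [] , m<r
  AllPairs-split (a ∷ l) m r (a<lmr ∷ s) with AllPairs-split l m r s | All.++⁻ l a<lmr
  ... | sl , sr , l<m , m<r | a<l , (a<m ∷ _) = (a<l ∷ sl) , sr , (a<m ∷ l<m) , m<r

  module Ancestors {n : ℕ} (b : Fin n → Fin n → Bool)
    (b-irrefl : ∀ x → b x x ≡ false)
    (b-trans : ∀ x y z → b x y ≡ true → b y z ≡ true → b x z ≡ true) where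

    -- y outranks every other key of ks between x and y; such a y is an ancestor of x.
    TopBetween : List (Fin n) → Fin n → Fin n → Set
    TopBetween ks x y = All (λ z → Between x z y → z ≡ y ⊎ T (b y z)) ks

    topBetween? : ∀ ks x y → Dec (TopBetween ks x y)
    topBetween? ks x y = All.all? (λ z → between? x z y →-dec (z Fin.≟ y ⊎-dec T? (b y z))) ks

    countTop : List (Fin n) → Fin n → ℕ
    countTop ks x = sumℕ ks (λ y → 𝟙 (does (topBetween? ks x y)))

    private
      maxBy-≡⊎beats : ∀ m zs → maxBy b m zs ≡ m ⊎ b (maxBy b m zs) m ≡ true
      maxBy-≡⊎beats m []       = inj₁ refl
      maxBy-≡⊎beats m (z ∷ zs) with b z m in z≻m
      ... | false = maxBy-≡⊎beats m zs
      ... | true with maxBy-≡⊎beats z zs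
      ...   | inj₁ eq  rewrite eq = inj₂ z≻m
      ...   | inj₂ w≻z = inj₂ (b-trans _ z m w≻z z≻m)

      unbeaten-maxBy : ∀ w m zs → b w m ≡ false → b w (maxBy b m zs) ≡ false
      unbeaten-maxBy w m zs w⊁m with maxBy-≡⊎beats m zs
      ... | inj₁ eq rewrite eq = w⊁m
      ... | inj₂ M≻m with b w (maxBy b m zs) in w≻M
      ...   | false = refl
      ...   | true  = trans (sym (b-trans w _ m w≻M M≻m)) w⊁m

    maxBy-maximal : ∀ m zs → All (λ z → b z (maxBy b m zs) ≡ false) (m ∷ zs)
    maxBy-maximal m []       = b-irrefl m ∷ []
    maxBy-maximal m (z ∷ zs) with b z m in z≻m
    ... | false with maxBy-maximal m zs
    ...   | m⊁M ∷ zs⊁M = m⊁M ∷ unbeaten-maxBy z m zs z≻m ∷ zs⊁M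
    maxBy-maximal m (z ∷ zs) | true with maxBy-maximal z zs
    ...   | z⊁M ∷ zs⊁M = unbeaten-maxBy m z zs m⊁z ∷ z⊁M ∷ zs⊁M
      where
      m⊁z : b m z ≡ false
      m⊁z with b m z in m≻z
      ... | false = refl
      ... | true  = trans (sym (b-trans m z m m≻z z≻m)) (b-irrefl m)

    maxBy-∈ : ∀ m zs → maxBy b m zs ∈ m ∷ zs
    maxBy-∈ m []       = here refl
    maxBy-∈ m (z ∷ zs) with b z m
    ... | true  = there (maxBy-∈ z zs)
    ... | false with maxBy-∈ m zs
    ...   | here eq   = here eq
    ...   | there M∈ = there (there M∈)

    splitKeys-++ : ∀ {m : Fin n} ks → m ∈ ks → ks ≡ proj₁ (splitKeys m ks) ++ m ∷ proj₂ (splitKeys m ks)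
    splitKeys-++ {m} (z ∷ zs) m∈ with eqFin z m | eqFin-reflects z m
    ... | true  | ofʸ refl = refl
    ... | false | ofⁿ z≢m with m∈
    ...   | here m≡z  = ⊥-elim (z≢m (sym m≡z))
    ...   | there m∈zs = cong (z ∷_) (splitKeys-++ zs m∈zs)

    private
      not-top-if-blocked : ∀ {l m r x y} → b y m ≡ false → y ≢ m → Between x m y → ¬ TopBetween (l ++ m ∷ r) x y
      not-top-if-blocked {l} {m} {r} y⊁m y≢m between top with All.lookup top (∈-insert l {r}) between
      ... | inj₁ m≡y = y≢m (sym m≡y)
      ... | inj₂ y≻m = subst T y⊁m y≻m

      countTop-node : ∀ l m r x (L R : Tree (Fin n)) →
        All (λ z → b z m ≡ false) (l ++ m ∷ r) → AllPairs Fin._<_ (l ++ m ∷ r) →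
        countTop l x ≤ depth L x → countTop r x ≤ depth R x → countTop (l ++ m ∷ r) x ≤ depth (node L m R) x
      countTop-node l m r x L R maximal sorted countL countR =
        subst (_≤ depth (node L m R) x) (sym (sumℕ-++ l (m ∷ r) g)) (byCases (Fin.<-cmp x m))
        where
        open ≤-Reasoning
        g = λ y → 𝟙 (does (topBetween? (l ++ m ∷ r) x y))
        l<m = proj₁ (proj₂ (proj₂ (AllPairs-split l m r sorted)))
        m<r = proj₂ (proj₂ (proj₂ (AllPairs-split l m r sorted)))
        l⊁m = All.++⁻ˡ l maximal
        r⊁m = All.tail (All.++⁻ʳ l maximal)
        blockedˡ : (∀ {y} → y Fin.< m → Between x m y) → sumℕ l g ≡ 0
        blockedˡ btw = sumℕ-zero (All.zipWith (λ (y<m , y⊁m) → 𝟙-does-no (topBetween? (l ++ m ∷ r) x _)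
          (not-top-if-blocked {l} {m} {r} y⊁m (Fin.<⇒≢ y<m) (btw y<m))) (l<m , l⊁m))
        blockedʳ : (∀ {y} → m Fin.< y → Between x m y) → sumℕ r g ≡ 0
        blockedʳ btw = sumℕ-zero (All.zipWith (λ (m<y , y⊁m) → 𝟙-does-no (topBetween? (l ++ m ∷ r) x _)
          (not-top-if-blocked {l} {m} {r} y⊁m (≢-sym (Fin.<⇒≢ m<y)) (btw m<y))) (m<r , r⊁m))
        restrictˡ : sumℕ l g ≤ countTop l x
        restrictˡ = sumℕ-mono l (λ y → 𝟙-does-mono (topBetween? (l ++ m ∷ r) x y) (topBetween? l x y) (All.++⁻ˡ l))
        restrictʳ : sumℕ r g ≤ countTop r x
        restrictʳ = sumℕ-mono r (λ y → 𝟙-does-mono (topBetween? (l ++ m ∷ r) x y) (topBetween? r x y) (All.tail ∘ All.++⁻ʳ l))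
        byCases : Tri (x Fin.< m) (x ≡ m) (m Fin.< x) → sumℕ l g + (g m + sumℕ r g) ≤ depth (node L m R) x
        byCases (tri≈ _ x≡m _) = begin
          sumℕ l g + (g m + sumℕ r g) ≡⟨ cong₂ (λ a c → a + (g m + c))
                                          (blockedˡ (λ y<m → inj₂ (<⇒≤ y<m , ≤-reflexive (cong toℕ (sym x≡m)))))
                                          (blockedʳ (λ m<y → inj₁ (≤-reflexive (cong toℕ x≡m) , <⇒≤ m<y))) ⟩
          0 + (g m + 0)               ≤⟨ +-monoˡ-≤ 0 (𝟙≤1 _) ⟩
          1                           ≡⟨ trans (cong (depth (node L m R)) x≡m) (depth-node-≡ L R m) ⟨
          depth (node L m R) x        ∎
        byCases (tri< x<m _ _) = begin
          sumℕ l g + (g m + sumℕ r g) ≡⟨ cong (λ c → sumℕ l g + (g m + c))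
                                          (blockedʳ (λ m<y → inj₁ (<⇒≤ x<m , <⇒≤ m<y))) ⟩
          sumℕ l g + (g m + 0)        ≤⟨ +-mono-≤ (≤-trans restrictˡ countL) (+-monoˡ-≤ 0 (𝟙≤1 _)) ⟩
          depth L x + 1               ≡⟨ +-comm _ 1 ⟩
          suc (depth L x)             ≡⟨ depth-node-< L R x<m ⟨
          depth (node L m R) x        ∎
        byCases (tri> _ _ m<x) = begin
          sumℕ l g + (g m + sumℕ r g) ≡⟨ cong (λ a → a + (g m + sumℕ r g))
                                          (blockedˡ (λ y<m → inj₂ (<⇒≤ y<m , <⇒≤ m<x))) ⟩
          0 + (g m + sumℕ r g)        ≤⟨ +-mono-≤ (𝟙≤1 _) (≤-trans restrictʳ countR) ⟩
          suc (depth R x)             ≡⟨ depth-node-> L R m<x ⟨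
          depth (node L m R) x        ∎

    countTop≤depth : ∀ f ks x → length ks ≤ f → AllPairs Fin._<_ ks → countTop ks x ≤ depth (buildFuel b f ks) x
    countTop≤depth zero    []       x _   _      = z≤n
    countTop≤depth (suc f) []       x _   _      = z≤n
    countTop≤depth (suc f) (k ∷ ks) x len sorted =
      subst (λ K → countTop K x ≤ depth (buildFuel b (suc f) (k ∷ ks)) x) (sym ks≡)
        (countTop-node l m r x (buildFuel b f l) (buildFuel b f r)
          (subst (All (λ z → b z m ≡ false)) ks≡ (maxBy-maximal k ks)) sorted′
          (countTop≤depth f l x (≤-pred (≤-trans (s≤s (m≤m+n (length l) (length r))) len′)) sortedˡ)
          (countTop≤depth f r x (≤-pred (≤-trans (s≤s (m≤n+m (length r) (length l))) len′)) sortedʳ))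
      where
      m = maxBy b k ks
      l = proj₁ (splitKeys m (k ∷ ks))
      r = proj₂ (splitKeys m (k ∷ ks))
      ks≡ : k ∷ ks ≡ l ++ m ∷ r
      ks≡ = splitKeys-++ (k ∷ ks) (maxBy-∈ k ks)
      sorted′ = subst (AllPairs Fin._<_) ks≡ sorted
      sortedˡ = proj₁ (AllPairs-split l m r sorted′)
      sortedʳ = proj₁ (proj₂ (AllPairs-split l m r sorted′))
      len′ : suc (length l + length r) ≤ suc f
      len′ = subst (_≤ suc f) (trans (cong length ks≡) (trans (length-++ l) (+-suc (length l) (length r)))) len

  lexᵇ : ℕ → ℕ → Bool → Bool
  lexᵇ a c t = if a <ᵇ c then true else (if c <ᵇ a then false else t)

  lexᵇ-< : ∀ {a c} t → a < c → lexᵇ a c t ≡ true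
  lexᵇ-< {a} {c} t a<c rewrite reflects-yes (<ᵇ-reflects-< a c) a<c = refl

  lexᵇ-≡ : ∀ a t → lexᵇ a a t ≡ t
  lexᵇ-≡ a t rewrite <ᵇ-irrefl a = refl

  lexᵇ-inv : ∀ a c t → lexᵇ a c t ≡ true → a < c ⊎ (a ≡ c × t ≡ true)
  lexᵇ-inv a c t lex with a <ᵇ c | <ᵇ-reflects-< a c
  ... | true  | ofʸ a<c = inj₁ a<c
  ... | false | ofⁿ a≮c with c <ᵇ a | <ᵇ-reflects-< c a
  ...   | false | ofⁿ c≮a = inj₂ (≤-antisym (≮⇒≥ c≮a) (≮⇒≥ a≮c) , lex)

  lexᵇ-trans : ∀ a c d {t u v} → (t ≡ true → u ≡ true → v ≡ true) →
    lexᵇ a c t ≡ true → lexᵇ c d u ≡ true → lexᵇ a d v ≡ true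
  lexᵇ-trans a c d {v = v} tuv ac cd with lexᵇ-inv a c _ ac | lexᵇ-inv c d _ cd
  ... | inj₁ a<c         | inj₁ c<d         = lexᵇ-< v (<-trans a<c c<d)
  ... | inj₁ a<c         | inj₂ (refl , _)  = lexᵇ-< v a<c
  ... | inj₂ (refl , _)  | inj₁ c<d         = lexᵇ-< v c<d
  ... | inj₂ (refl , t)  | inj₂ (refl , u)  = trans (lexᵇ-≡ a v) (tuv t u)

  module _ {n : ℕ} (p : Fin n → ℚ) (σ : List (Fin n)) where

    beats-positive : ∀ y z → isZeroℚ (p y) ≡ false → isZeroℚ (p z) ≡ false →
      beats p σ y z ≡ lexᵇ (level (p y)) (level (p z)) (before σ y z)
    beats-positive y z py≢0 pz≢0 rewrite py≢0 | pz≢0 = refl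

    beats-irrefl : ∀ x → beats p σ x x ≡ false
    beats-irrefl x with isZeroℚ (p x)
    ... | true  = before-irrefl σ x
    ... | false = trans (lexᵇ-≡ (level (p x)) _) (before-irrefl σ x)

    beats-trans : ∀ x y z → beats p σ x y ≡ true → beats p σ y z ≡ true → beats p σ x z ≡ true
    beats-trans x y z xy yz with isZeroℚ (p x) | isZeroℚ (p y) | isZeroℚ (p z)
    ... | true  | true  | true  = before-trans σ x y z xy yz
    ... | false | true  | true  = refl
    ... | false | false | true  = refl
    ... | false | false | false = lexᵇ-trans (level (p x)) (level (p y)) (level (p z)) (before-trans σ x y z) xy yz
    beats-trans x y z () yz | true  | false | _
    beats-trans x y z xy () | true  | true  | false
    beats-trans x y z xy () | false | true  | false

    open Ancestors (beats p σ) beats-irrefl beats-trans public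
      using (TopBetween; topBetween?; countTop; countTop≤depth)

    countTop≤depth-treap : ∀ x → countTop (allFin n) x ≤ depth (treap n p σ) x
    countTop≤depth-treap x =
      countTop≤depth n (allFin n) x (≤-reflexive (length-tabulate (λ z → z))) (AllPairs.tabulate⁺-< (λ i<j → i<j))

  oneOver : (d : ℕ) → .{{NonZero d}} → ℚ
  oneOver d = mkℚ+ 1 d (1-coprimeTo d)

  oneOver-cong : ∀ {a b} .{{_ : NonZero a}} .{{_ : NonZero b}} → a ≡ b → oneOver a ≡ oneOver b
  oneOver-cong refl = refl

  oneOver-positive : ∀ d .{{_ : NonZero d}} → 0ℚ ℚ.< oneOver d
  oneOver-positive (suc d) = ℚ.*<* (ℤ.+<+ z<s)

  private
    toℚᵘ-ℕtoℚ : ∀ a → toℚᵘ (ℕtoℚ a) ℚᵘ.≃ ℚᵘ.mkℚᵘ (ℤ.+ a) 0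
    toℚᵘ-ℕtoℚ a = ℚᴾ.toℚᵘ-fromℚᵘ (ℚᵘ.mkℚᵘ (ℤ.+ a) 0)

    toℚᵘ-ℕtoℚ-* : ∀ a q → toℚᵘ (ℕtoℚ a ℚ.* q) ℚᵘ.≃ ℚᵘ.mkℚᵘ (ℤ.+ a) 0 ℚᵘ.* toℚᵘ q
    toℚᵘ-ℕtoℚ-* a q = ℚᵘᴾ.≃-trans (ℚᴾ.toℚᵘ-homo-* (ℕtoℚ a) q) (ℚᵘᴾ.*-congʳ (toℚᵘ-ℕtoℚ a))

  ℕtoℚ-+ : ∀ a b → ℕtoℚ (a + b) ≡ ℕtoℚ a ℚ.+ ℕtoℚ b
  ℕtoℚ-+ a b = ℚᴾ.toℚᵘ-injective (ℚᵘᴾ.≃-trans (toℚᵘ-ℕtoℚ (a + b)) (ℚᵘᴾ.≃-trans homo (ℚᵘᴾ.≃-sym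
    (ℚᵘᴾ.≃-trans (ℚᴾ.toℚᵘ-homo-+ (ℕtoℚ a) (ℕtoℚ b)) (ℚᵘᴾ.+-cong (toℚᵘ-ℕtoℚ a) (toℚᵘ-ℕtoℚ b))))))
    where
    lemma : ∀ (x y : ℤ) → (x ℤ.+ y) ℤ.* ℤ.1ℤ ≡ (x ℤ.* ℤ.1ℤ ℤ.+ y ℤ.* ℤ.1ℤ) ℤ.* ℤ.1ℤ
    lemma = ℤ-solve-∀
    homo : ℚᵘ.mkℚᵘ (ℤ.+ (a + b)) 0 ℚᵘ.≃ ℚᵘ.mkℚᵘ (ℤ.+ a) 0 ℚᵘ.+ ℚᵘ.mkℚᵘ (ℤ.+ b) 0
    homo = ℚᵘ.*≡* (trans (cong (ℤ._* ℤ.1ℤ) (ℤᴾ.pos-+ a b)) (lemma (ℤ.+ a) (ℤ.+ b)))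

  ℕtoℚ-* : ∀ a b → ℕtoℚ (a * b) ≡ ℕtoℚ a ℚ.* ℕtoℚ b
  ℕtoℚ-* a b = ℚᴾ.toℚᵘ-injective (ℚᵘᴾ.≃-trans (toℚᵘ-ℕtoℚ (a * b)) (ℚᵘᴾ.≃-trans homo (ℚᵘᴾ.≃-sym
    (ℚᵘᴾ.≃-trans (ℚᴾ.toℚᵘ-homo-* (ℕtoℚ a) (ℕtoℚ b)) (ℚᵘᴾ.*-cong (toℚᵘ-ℕtoℚ a) (toℚᵘ-ℕtoℚ b))))))
    where
    homo : ℚᵘ.mkℚᵘ (ℤ.+ (a * b)) 0 ℚᵘ.≃ ℚᵘ.mkℚᵘ (ℤ.+ a) 0 ℚᵘ.* ℚᵘ.mkℚᵘ (ℤ.+ b) 0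
    homo = ℚᵘ.*≡* (cong (ℤ._* ℤ.1ℤ) (ℤᴾ.pos-* a b))

  *-oneOver-mono : ∀ a c d₁ d₂ .{{_ : NonZero d₁}} .{{_ : NonZero d₂}} → a * d₂ ≤ c * d₁ →
    ℕtoℚ a ℚ.* oneOver d₁ ℚ.≤ ℕtoℚ c ℚ.* oneOver d₂
  *-oneOver-mono a c (suc d₁) (suc d₂) ad₂≤cd₁ = ℚᴾ.toℚᵘ-cancel-≤
    (ℚᵘᴾ.≤-respˡ-≃ (ℚᵘᴾ.≃-sym (toℚᵘ-ℕtoℚ-* a (oneOver (suc d₁))))
    (ℚᵘᴾ.≤-respʳ-≃ (ℚᵘᴾ.≃-sym (toℚᵘ-ℕtoℚ-* c (oneOver (suc d₂))))
      (ℚᵘ.*≤* (subst₂ ℤ._≤_ (cross a d₂) (cross c d₁) (ℤ.+≤+ ad₂≤cd₁)))))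
    where
    cross : ∀ x d → ℤ.+ (x * suc d) ≡ (ℤ.+ x ℤ.* ℤ.+ 1) ℤ.* (ℤ.+ (1 * suc d))
    cross x d = trans (cong (λ k → ℤ.+ (x * k)) (sym (*-identityˡ (suc d))))
      (trans (ℤᴾ.pos-* x (1 * suc d)) (cong (ℤ._* ℤ.+ (1 * suc d)) (sym (ℤᴾ.*-identityʳ (ℤ.+ x)))))

  ℕtoℚ-*-oneOver : ∀ a m .{{_ : NonZero a}} .{{_ : NonZero m}} .{{_ : NonZero (a * m)}} →
    ℕtoℚ a ℚ.* oneOver (a * m) ≡ oneOver m
  ℕtoℚ-*-oneOver a m = ℚᴾ.toℚᵘ-injective (ℚᵘᴾ.≃-trans (toℚᵘ-ℕtoℚ-* a (oneOver (a * m))) (cancel a m))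
    where
    cancel : ∀ a m .{{_ : NonZero m}} .{{_ : NonZero (a * m)}} →
      ℚᵘ.mkℚᵘ (ℤ.+ a) 0 ℚᵘ.* toℚᵘ (oneOver (a * m)) ℚᵘ.≃ toℚᵘ (oneOver m)
    cancel a (suc m) with a * suc m in a*m≡
    ... | suc k = ℚᵘ.*≡* (trans (cong (ℤ._* ℤ.+ suc m) (ℤᴾ.*-identityʳ (ℤ.+ a)))
      (trans (sym (ℤᴾ.pos-* a (suc m)))
        (trans (cong ℤ.+_ (trans a*m≡ (cong suc (sym (+-identityʳ k))))) (sym (ℤᴾ.*-identityˡ _)))))

  ℕtoℚ-*-oneOver-self : ∀ m .{{_ : NonZero m}} → ℕtoℚ m ℚ.* oneOver m ≡ 1ℚ
  ℕtoℚ-*-oneOver-self (suc m) = trans (cong (ℕtoℚ (suc m) ℚ.*_) (oneOver-cong (sym (*-identityʳ (suc m)))))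
    (ℕtoℚ-*-oneOver (suc m) 1)

  level-oneOver : ∀ d .{{_ : NonZero d}} → level (oneOver d) ≡ ⌊log₂ d ⌋
  level-oneOver (suc d) = cong ⌊log₂_⌋ (n/1≡n (suc d))

  isZeroℚ-oneOver : ∀ d .{{_ : NonZero d}} → isZeroℚ (oneOver d) ≡ false
  isZeroℚ-oneOver (suc d) = refl

  sumℚ-cong : ∀ {A : Set} (xs : List A) {f g : A → ℚ} → (∀ a → f a ≡ g a) → sumℚ xs f ≡ sumℚ xs g
  sumℚ-cong []       e = refl
  sumℚ-cong (x ∷ xs) e = cong₂ ℚ._+_ (e x) (sumℚ-cong xs e)

  sumℚ-ℕtoℚ-* : ∀ {A : Set} (xs : List A) (h : A → ℕ) q →
    sumℚ xs (λ a → ℕtoℚ (h a) ℚ.* q) ≡ ℕtoℚ (sumℕ xs h) ℚ.* q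
  sumℚ-ℕtoℚ-* []       h q = sym (ℚᴾ.*-zeroˡ q)
  sumℚ-ℕtoℚ-* (x ∷ xs) h q = begin
    ℕtoℚ (h x) ℚ.* q ℚ.+ sumℚ xs (λ a → ℕtoℚ (h a) ℚ.* q) ≡⟨ cong (ℕtoℚ (h x) ℚ.* q ℚ.+_) (sumℚ-ℕtoℚ-* xs h q) ⟩
    ℕtoℚ (h x) ℚ.* q ℚ.+ ℕtoℚ (sumℕ xs h) ℚ.* q          ≡⟨ ℚᴾ.*-distribʳ-+ q (ℕtoℚ (h x)) _ ⟨
    (ℕtoℚ (h x) ℚ.+ ℕtoℚ (sumℕ xs h)) ℚ.* q              ≡⟨ cong (ℚ._* q) (ℕtoℚ-+ (h x) _) ⟨
    ℕtoℚ (h x + sumℕ xs h) ℚ.* q                         ∎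
    where open ≡-Reasoning

  ℕtoℚ-*-swap : ∀ a q k → ℕtoℚ a ℚ.* q ℚ.* ℕtoℚ k ≡ ℕtoℚ (a * k) ℚ.* q
  ℕtoℚ-*-swap a q k = begin
    ℕtoℚ a ℚ.* q ℚ.* ℕtoℚ k   ≡⟨ ℚᴾ.*-assoc (ℕtoℚ a) q _ ⟩
    ℕtoℚ a ℚ.* (q ℚ.* ℕtoℚ k) ≡⟨ cong (ℕtoℚ a ℚ.*_) (ℚᴾ.*-comm q _) ⟩
    ℕtoℚ a ℚ.* (ℕtoℚ k ℚ.* q) ≡⟨ ℚᴾ.*-assoc (ℕtoℚ a) _ q ⟨
    ℕtoℚ a ℚ.* ℕtoℚ k ℚ.* q   ≡⟨ cong (ℚ._* q) (ℕtoℚ-* a k) ⟨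
    ℕtoℚ (a * k) ℚ.* q        ∎
    where open ≡-Reasoning

  module _ {n : ℕ} (w : Fin n → ℕ) (d : ℕ) .{{_ : NonZero d}} (w-total : sumℕ (allFin n) w ≡ d) where

    weighted : Distribution n
    weighted = record
      { prob    = λ x → ℕtoℚ (w x) ℚ.* oneOver d
      ; nonneg  = λ x → subst (ℚ._≤ ℕtoℚ (w x) ℚ.* oneOver d) (ℚᴾ.*-zeroˡ (oneOver 1)) (*-oneOver-mono 0 (w x) 1 d z≤n)
      ; sumsTo1 = trans (sumℚ-ℕtoℚ-* (allFin n) w (oneOver d))
                    (trans (cong (λ s → ℕtoℚ s ℚ.* oneOver d) w-total) (ℕtoℚ-*-oneOver-self d))
      }

    totalWeightedDepth-weighted : totalWeightedDepth n weighted ≡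
      ℕtoℚ (sumℕ (perms (allFin n)) (λ σ → sumℕ (allFin n) (λ x → w x * depth (treap n (prob weighted) σ) x))) ℚ.* oneOver d
    totalWeightedDepth-weighted = trans
      (sumℚ-cong (perms (allFin n)) (λ σ → trans
        (sumℚ-cong (allFin n) (λ x → ℕtoℚ-*-swap (w x) (oneOver d) (depth (treap n (prob weighted) σ) x)))
        (sumℚ-ℕtoℚ-* (allFin n) (λ x → w x * depth (treap n (prob weighted) σ) x) (oneOver d))))
      (sumℚ-ℕtoℚ-* (perms (allFin n)) _ (oneOver d))

  -- A distribution with expected depth Ω(log² n)

  -- Keys [0, B) are the queried keys, of level 3G + 2 and total mass 1/2; then come G segments of S keys, the
  -- k-th of level 3G - k; the key F gets whatever mass is left, and all later keys get probability 0.
  segmentLength queryCount fillerPosition : ℕ → ℕ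
  segmentLength G  = 2 ^ G
  queryCount G     = 2 ^ (3 * G + 1)
  fillerPosition G = queryCount G + G * segmentLength G

  segments-light : ∀ G → G * segmentLength G * 2 ^ suc G ≤ queryCount G
  segments-light G = begin
    G * 2 ^ G * 2 ^ suc G        ≤⟨ *-monoˡ-≤ (2 ^ suc G) (*-monoˡ-≤ (2 ^ G) (<⇒≤ (n<2^n G))) ⟩
    2 ^ G * 2 ^ G * 2 ^ suc G    ≡⟨ cong (_* 2 ^ suc G) (^-distribˡ-+-* 2 G G) ⟨
    2 ^ (G + G) * 2 ^ suc G      ≡⟨ ^-distribˡ-+-* 2 (G + G) (suc G) ⟨
    2 ^ (G + G + suc G)          ≡⟨ cong (2 ^_) (exponent G) ⟩
    2 ^ (3 * G + 1)              ∎
    where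
    open ≤-Reasoning
    n<2^n : ∀ n → n < 2 ^ n
    n<2^n zero    = z<s
    n<2^n (suc n) = +-mono-≤-< (^-monoʳ-≤ 2 {0} {n} z≤n) (subst (n <_) (sym (+-identityʳ (2 ^ n))) (n<2^n n))
    exponent : ∀ G → G + G + suc G ≡ 3 * G + 1
    exponent = solve-∀

  fillerPosition<2^[3G+2] : ∀ G → 1 ≤ G → fillerPosition G < 2 ^ (3 * G + 2)
  fillerPosition<2^[3G+2] G G≥1 = begin-strict
    B + G * S              <⟨ +-monoʳ-< B (<-≤-trans (m<m*n (G * S) 2 ≤-refl)
                                                (*-monoʳ-≤ (G * S) (^-monoʳ-≤ 2 {1} {suc G} (s≤s z≤n)))) ⟩
    B + G * S * 2 ^ suc G  ≤⟨ +-monoʳ-≤ B (segments-light G) ⟩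
    B + B                  ≡⟨ cong (B +_) (+-identityʳ B) ⟨
    2 * B                  ≡⟨ cong (2 ^_) (+-suc (3 * G) 1) ⟨
    2 ^ (3 * G + 2)        ∎
    where
    open ≤-Reasoning
    B = queryCount G
    S = segmentLength G
    instance
      G*S≢0 : NonZero (G * S)
      G*S≢0 = m*n≢0 G S {{ℕ.>-nonZero G≥1}} {{m^n≢0 2 G}}

  module HardInstance (G n : ℕ) (G≥1 : 1 ≤ G) (F<n : fillerPosition G < n) where

    S = segmentLength G
    B = queryCount G
    F = fillerPosition G
    M = 3 * G + 2

    instance
      S≢0 : NonZero S
      S≢0 = m^n≢0 2 G
      2^M≢0 : NonZero (2 ^ M)
      2^M≢0 = m^n≢0 2 M

    segment : ℕ → ℕ
    segment i = (i ∸ B) / S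

    segmentStart : ℕ → ℕ
    segmentStart i = B + segment i * S

    levelAt : ℕ → ℕ
    levelAt i = if i <ᵇ B then M else 3 * G ∸ segment i

    levelWeight : ℕ → ℕ
    levelWeight i = 2 ^ (M ∸ levelAt i)

    weight : ℕ → ℕ
    weight i = if i <ᵇ F then levelWeight i else (if i ≡ᵇ F then 2 ^ M ∸ sumBelow F levelWeight else 0)

    levelAt-query : ∀ {i} → i < B → levelAt i ≡ M
    levelAt-query {i} i<B rewrite reflects-yes (<ᵇ-reflects-< i B) i<B = refl

    levelAt-segment : ∀ {i} → B ≤ i → levelAt i ≡ 3 * G ∸ segment i
    levelAt-segment {i} B≤i rewrite reflects-no (<ᵇ-reflects-< i B) (≤⇒≯ B≤i) = refl

    levelAt≤M : ∀ i → levelAt i ≤ M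
    levelAt≤M i with i <ᵇ B
    ... | true  = ≤-refl
    ... | false = ≤-trans (m∸n≤m (3 * G) (segment i)) (m≤m+n (3 * G) 2)

    segment-≥ : ∀ {i} k → B + k * S ≤ i → k ≤ segment i
    segment-≥ {i} k B+kS≤i = subst (_≤ segment i) (m*n/n≡m k S)
      (/-monoˡ-≤ S (subst (_≤ i ∸ B) (m+n∸m≡n B (k * S)) (∸-monoˡ-≤ B B+kS≤i)))

    segment-< : ∀ {i} k → B ≤ i → i < B + k * S → segment i < k
    segment-< {i} k B≤i i<B+kS = m<n*o⇒m/o<n (subst (i ∸ B <_) (m+n∸m≡n B (k * S)) (∸-monoˡ-< i<B+kS B≤i))

    segment-block : ∀ k {j} → j < S → segment (B + (k * S + j)) ≡ k
    segment-block k {j} j<S = ≤-antisym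
      (≤-pred (segment-< (suc k) (m≤m+n B _) (+-monoʳ-< B (subst (k * S + j <_) (+-comm (k * S) S) (+-monoʳ-< (k * S) j<S)))))
      (segment-≥ k (+-monoʳ-≤ B (m≤m+n (k * S) j)))

    levelAt-earlier : ∀ {i j} → B ≤ j → j < F → i < segmentStart j → levelAt j < levelAt i
    levelAt-earlier {i} {j} B≤j j<F i<start with i <? B
    ... | yes i<B rewrite levelAt-segment B≤j | levelAt-query i<B = ≤-<-trans (m∸n≤m (3 * G) (segment j)) (m<m+n (3 * G) z<s)
    ... | no  i≮B rewrite levelAt-segment B≤j | levelAt-segment (≮⇒≥ i≮B) =
      ∸-monoʳ-< (segment-< (segment j) (≮⇒≥ i≮B) i<start) (≤-trans (<⇒≤ (segment-< G B≤j j<F)) (m≤n*m G 3))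

    levelAt-same : ∀ {i j} → segmentStart j ≤ i → i ≤ j → levelAt i ≡ levelAt j
    levelAt-same {i} {j} start≤i i≤j
      rewrite levelAt-segment (≤-trans (m≤m+n B _) start≤i) | levelAt-segment (≤-trans (m≤m+n B _) (≤-trans start≤i i≤j)) =
      cong (3 * G ∸_) (≤-antisym (/-monoˡ-≤ S (∸-monoˡ-≤ B i≤j)) (segment-≥ (segment j) start≤i))

    2^M≡2*B : 2 ^ M ≡ 2 * B
    2^M≡2*B = cong (2 ^_) (+-suc (3 * G) 1)

    levelWeight-segment : ∀ i → i < G * S → levelWeight (B + i) ≤ 2 ^ suc G
    levelWeight-segment i i<GS rewrite levelAt-segment (m≤m+n B i) = ^-monoʳ-≤ 2 (m≤n+o⇒m∸n≤o M (3 * G ∸ s) (begin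
      3 * G + 2               ≡⟨ cong (_+ 2) (m∸n+n≡m s≤3G) ⟨
      3 * G ∸ s + s + 2       ≡⟨ +-assoc (3 * G ∸ s) s 2 ⟩
      3 * G ∸ s + (s + 2)     ≤⟨ +-monoʳ-≤ (3 * G ∸ s) (subst (_≤ suc G) (+-comm 2 s) (s≤s s<G)) ⟩
      3 * G ∸ s + suc G       ∎))
      where
      open ≤-Reasoning
      s = segment (B + i)
      s<G : s < G
      s<G = segment-< G (m≤m+n B i) (+-monoʳ-< B i<GS)
      s≤3G : s ≤ 3 * G
      s≤3G = ≤-trans (<⇒≤ s<G) (m≤n*m G 3)

    sumBelow-levelWeight : sumBelow F levelWeight ≤ 2 ^ M
    sumBelow-levelWeight = begin
      sumBelow (B + G * S) levelWeight
        ≡⟨ sumBelow-+ B (G * S) levelWeight ⟩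
      sumBelow B levelWeight + sumBelow (G * S) (λ i → levelWeight (B + i))
        ≤⟨ +-mono-≤ (≤-reflexive queries) (sumBelow-mono (G * S) levelWeight-segment) ⟩
      B + sumBelow (G * S) (λ _ → 2 ^ suc G)
        ≤⟨ +-monoʳ-≤ B (≤-trans (≤-reflexive (sumBelow-const (G * S) (2 ^ suc G))) (segments-light G)) ⟩
      B + B
        ≡⟨ trans 2^M≡2*B (cong (B +_) (+-identityʳ B)) ⟨
      2 ^ M ∎
      where
      open ≤-Reasoning
      queries : sumBelow B levelWeight ≡ B
      queries = trans (sumBelow-cong B (λ i i<B → cong (λ l → 2 ^ (M ∸ l)) (levelAt-query i<B)))
        (trans (cong (λ e → sumBelow B (λ _ → 2 ^ e)) (n∸n≡0 M)) (trans (sumBelow-const B 1) (*-identityʳ B)))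

    weight-<F : ∀ {i} → i < F → weight i ≡ levelWeight i
    weight-<F {i} i<F rewrite reflects-yes (<ᵇ-reflects-< i F) i<F = refl

    sumBelow-weight : sumBelow n weight ≡ 2 ^ M
    sumBelow-weight = begin
      sumBelow n weight
        ≡⟨ cong (λ m → sumBelow m weight) n≡ ⟨
      sumBelow (F + suc r) weight
        ≡⟨ sumBelow-+ F (suc r) weight ⟩
      sumBelow F weight + (weight (F + 0) + sumBelow r (λ i → weight (F + suc i)))
        ≡⟨ cong₂ (λ a c → a + (c + sumBelow r (λ i → weight (F + suc i))))
             (sumBelow-cong F (λ i i<F → weight-<F i<F)) (trans (cong weight (+-identityʳ F)) filler) ⟩
      W + ((2 ^ M ∸ W) + sumBelow r (λ i → weight (F + suc i)))
        ≡⟨ cong (λ c → W + ((2 ^ M ∸ W) + c)) (sumBelow-zero r (λ i _ → beyond (F + suc i) (m<m+n F z<s))) ⟩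
      W + ((2 ^ M ∸ W) + 0)
        ≡⟨ trans (cong (W +_) (+-identityʳ _)) (m+[n∸m]≡n sumBelow-levelWeight) ⟩
      2 ^ M ∎
      where
      open ≡-Reasoning
      W = sumBelow F levelWeight
      r = n ∸ suc F
      n≡ : F + suc r ≡ n
      n≡ = trans (+-suc F r) (m+[n∸m]≡n F<n)
      filler : weight F ≡ 2 ^ M ∸ W
      filler rewrite <ᵇ-irrefl F | reflects-yes (≡ᵇ-reflects-≡ F F) refl = refl
      beyond : ∀ i → F < i → weight i ≡ 0
      beyond i F<i rewrite reflects-no (<ᵇ-reflects-< i F) (<⇒≯ F<i)
                         | reflects-no (≡ᵇ-reflects-≡ i F) (≢-sym (<⇒≢ F<i)) = refl

    weight-total : sumℕ (allFin n) (weight ∘ toℕ) ≡ 2 ^ M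
    weight-total = trans (sumℕ-allFin-toℕ n weight) sumBelow-weight

    -- Opaque, so that type checking never normalises the rational probabilities inside treap.
    opaque
      D : Distribution n
      D = weighted (weight ∘ toℕ) (2 ^ M) weight-total

      prob-D : ∀ x → prob D x ≡ ℕtoℚ (weight (toℕ x)) ℚ.* oneOver (2 ^ M)
      prob-D x = refl

    weightedDepth : List (Fin n) → ℕ
    weightedDepth σ = sumℕ (allFin n) (λ x → weight (toℕ x) * depth (treap n (prob D) σ) x)

    opaque
      unfolding D

      totalWeightedDepth-D : totalWeightedDepth n D ≡ ℕtoℚ (sumℕ (perms (allFin n)) weightedDepth) ℚ.* oneOver (2 ^ M)
      totalWeightedDepth-D = totalWeightedDepth-weighted {n} (weight ∘ toℕ) (2 ^ M) weight-total

    prob-<F : ∀ x → toℕ x < F → prob D x ≡ oneOver (2 ^ levelAt (toℕ x)) {{m^n≢0 2 (levelAt (toℕ x))}}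
    prob-<F x x<F = begin
      prob D x
        ≡⟨ prob-D x ⟩
      ℕtoℚ (weight (toℕ x)) ℚ.* oneOver (2 ^ M)
        ≡⟨ cong₂ ℚ._*_ (cong ℕtoℚ (weight-<F x<F)) (oneOver-cong {{_}} {{2^M∸L*2^L≢0}} 2^M≡) ⟩
      ℕtoℚ (2 ^ (M ∸ L)) ℚ.* oneOver (2 ^ (M ∸ L) * 2 ^ L) {{2^M∸L*2^L≢0}}
        ≡⟨ ℕtoℚ-*-oneOver (2 ^ (M ∸ L)) (2 ^ L) {{m^n≢0 2 (M ∸ L)}} {{m^n≢0 2 L}} {{2^M∸L*2^L≢0}} ⟩
      oneOver (2 ^ L) {{m^n≢0 2 L}} ∎
      where
      open ≡-Reasoning
      L = levelAt (toℕ x)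
      2^M∸L*2^L≢0 : NonZero (2 ^ (M ∸ L) * 2 ^ L)
      2^M∸L*2^L≢0 = m*n≢0 _ _ {{m^n≢0 2 (M ∸ L)}} {{m^n≢0 2 L}}
      2^M≡ : 2 ^ M ≡ 2 ^ (M ∸ L) * 2 ^ L
      2^M≡ = trans (cong (2 ^_) (sym (m∸n+n≡m (levelAt≤M (toℕ x))))) (^-distribˡ-+-* 2 (M ∸ L) L)

    beats-<F : ∀ σ y z → toℕ y < F → toℕ z < F →
      beats (prob D) σ y z ≡ lexᵇ (levelAt (toℕ y)) (levelAt (toℕ z)) (before σ y z)
    beats-<F σ y z y<F z<F = trans (beats-positive (prob D) σ y z (positive y y<F) (positive z z<F))
      (cong₂ (λ a c → lexᵇ a c (before σ y z)) (level-core y y<F) (level-core z z<F))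
      where
      positive : ∀ x → toℕ x < F → isZeroℚ (prob D x) ≡ false
      positive x x<F = trans (cong isZeroℚ (prob-<F x x<F)) (isZeroℚ-oneOver _ {{m^n≢0 2 (levelAt (toℕ x))}})
      level-core : ∀ x → toℕ x < F → level (prob D x) ≡ levelAt (toℕ x)
      level-core x x<F = trans (cong level (prob-<F x x<F))
        (trans (level-oneOver _ {{m^n≢0 2 (levelAt (toℕ x))}}) (⌊log₂[2^n]⌋≡n (levelAt (toℕ x))))

    segmentPredecessors : Fin n → List (Fin n)
    segmentPredecessors y = filterᵇ (λ z → inRangeᵇ (segmentStart (toℕ y)) (toℕ y) (toℕ z)) (allFin n)

    -- A queried key x lies before every segment; the levels strictly decrease from one segment to the
    -- next, so a key y that comes first in its segment up to y outranks every key between x and y.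
    top-if-first : ∀ σ x y → toℕ x < B → B ≤ toℕ y → toℕ y < F →
      precedesAll σ y (segmentPredecessors y) ≡ true → TopBetween (prob D) σ (allFin n) x y
    top-if-first σ x y x<B B≤y y<F first = All.universal outranked (allFin n)
      where
      x<y : x Fin.< y
      x<y = <-≤-trans x<B B≤y
      outranked : ∀ z → Between x z y → z ≡ y ⊎ T (beats (prob D) σ y z)
      outranked z (inj₂ (y≤z , z≤x)) = ⊥-elim (<-irrefl refl (<-≤-trans x<y (≤-trans y≤z z≤x)))
      outranked z (inj₁ (_ , z≤y)) with z Fin.≟ y
      ... | yes z≡y = inj₁ z≡y
      ... | no  z≢y = inj₂ (subst T (sym (beats-<F σ y z y<F z<F)) byLevel)
        where
        z<y : z Fin.< y
        z<y = ≤∧≢⇒< z≤y (z≢y ∘ toℕ-injective)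
        z<F : toℕ z < F
        z<F = <-trans z<y y<F
        byLevel : T (lexᵇ (levelAt (toℕ y)) (levelAt (toℕ z)) (before σ y z))
        byLevel with toℕ z <? segmentStart (toℕ y)
        ... | yes z<start = subst T (sym (lexᵇ-< _ (levelAt-earlier B≤y y<F z<start))) _
        ... | no  z≮start rewrite levelAt-same (≮⇒≥ z≮start) z≤y | lexᵇ-≡ (levelAt (toℕ y)) (before σ y z) =
          All.lookup (All.all⁺ (before σ y) _ (subst T (sym first) _))
            (∈-filter⁺ (T? ∘ _) (∈-allFin z) (reflects-T (inRangeᵇ-reflects _ _ _) (≮⇒≥ z≮start , z<y)))

    segmentRecords : List (Fin n) → ℕ
    segmentRecords σ = sumℕ (allFin n) (λ y → 𝟙 (inRangeᵇ B F (toℕ y)) * 𝟙 (precedesAll σ y (segmentPredecessors y)))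

    segmentRecords≤depth : ∀ σ x → toℕ x < B → segmentRecords σ ≤ depth (treap n (prob D) σ) x
    segmentRecords≤depth σ x x<B = ≤-trans (sumℕ-mono (allFin n) record⇒top) (countTop≤depth-treap (prob D) σ x)
      where
      record⇒top : ∀ y → 𝟙 (inRangeᵇ B F (toℕ y)) * 𝟙 (precedesAll σ y (segmentPredecessors y))
                       ≤ 𝟙 (does (topBetween? (prob D) σ (allFin n) x y))
      record⇒top y with inRangeᵇ B F (toℕ y) | inRangeᵇ-reflects B F (toℕ y) | precedesAll σ y (segmentPredecessors y) in first
      ... | false | _                | _     = z≤n
      ... | true  | ofʸ _            | false = z≤n
      ... | true  | ofʸ (B≤y , y<F)  | true  =
        ≤-reflexive (sym (𝟙-does-yes (topBetween? (prob D) σ (allFin n) x y) (top-if-first σ x y x<B B≤y y<F first)))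

    recordCount : Fin n → ℕ
    recordCount y = sumℕ (perms (allFin n)) (λ σ → 𝟙 (precedesAll σ y (segmentPredecessors y)))

    segmentRecordCount : Fin n → ℕ
    segmentRecordCount y = 𝟙 (inRangeᵇ B F (toℕ y)) * recordCount y

    segmentStart≤ : ∀ {i} → B ≤ i → segmentStart i ≤ i
    segmentStart≤ {i} B≤i = subst (B + segment i * S ≤_) (m+[n∸m]≡n B≤i) (+-monoʳ-≤ B (m/n*n≤m (i ∸ B) S))

    length-segmentPredecessors : ∀ y → B ≤ toℕ y → length (segmentPredecessors y) ≡ toℕ y ∸ segmentStart (toℕ y)
    length-segmentPredecessors y B≤y = begin
      length (segmentPredecessors y)
        ≡⟨ length-filterᵇ _ (allFin n) ⟩
      sumℕ (allFin n) (λ z → 𝟙 (inRangeᵇ start (toℕ y) (toℕ z)))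
        ≡⟨ sumℕ-allFin-toℕ n (𝟙 ∘ inRangeᵇ start (toℕ y)) ⟩
      sumBelow n (𝟙 ∘ inRangeᵇ start (toℕ y))
        ≡⟨ sumBelow-inRange n start (toℕ y) (segmentStart≤ B≤y) (<⇒≤ (Fin.toℕ<n y)) ⟩
      toℕ y ∸ start ∎
      where
      open ≡-Reasoning
      start = segmentStart (toℕ y)

    recordCount-bound : ∀ k j → k < G → j < S → n ! ≤ extend segmentRecordCount (B + (k * S + j)) * suc j
    recordCount-bound k j k<G j<S = begin
      n !                                                  ≤⟨ precedesAll-count-allFin y _ notBefore ⟩
      recordCount y * suc (length (segmentPredecessors y)) ≡⟨ cong₂ (λ a c → a * suc c) count≡ length≡j ⟩
      extend segmentRecordCount i * suc j                  ∎
      where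
      open ≤-Reasoning
      i = B + (k * S + j)
      i<F : i < F
      i<F = +-monoʳ-< B (<-≤-trans (+-monoʳ-< (k * S) j<S) (subst (_≤ G * S) (+-comm S (k * S)) (*-monoˡ-≤ S k<G)))
      i<n : i < n
      i<n = <-trans i<F F<n
      y = Fin.fromℕ< i<n
      y≡i : toℕ y ≡ i
      y≡i = Fin.toℕ-fromℕ< i<n
      notBefore : inRangeᵇ (segmentStart (toℕ y)) (toℕ y) (toℕ y) ≡ false
      notBefore = reflects-no (inRangeᵇ-reflects (segmentStart (toℕ y)) (toℕ y) (toℕ y)) (<-irrefl refl ∘ proj₂)
      count≡ : recordCount y ≡ extend segmentRecordCount i
      count≡ = sym (trans (extend-fromℕ< segmentRecordCount i<n) (trans (cong (λ b → 𝟙 b * recordCount y)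
        (reflects-yes (inRangeᵇ-reflects B F (toℕ y)) (subst (B ≤_) (sym y≡i) (m≤m+n B _) , subst (_< F) (sym y≡i) i<F)))
        (+-identityʳ _)))
      length≡j : length (segmentPredecessors y) ≡ j
      length≡j = begin-equality
        length (segmentPredecessors y)  ≡⟨ length-segmentPredecessors y (subst (B ≤_) (sym y≡i) (m≤m+n B _)) ⟩
        toℕ y ∸ segmentStart (toℕ y)    ≡⟨ cong (λ t → t ∸ segmentStart t) y≡i ⟩
        i ∸ (B + segment i * S)         ≡⟨ cong (λ s → i ∸ (B + s * S)) (segment-block k j<S) ⟩
        B + (k * S + j) ∸ (B + k * S)   ≡⟨ cong (_∸ (B + k * S)) (+-assoc B (k * S) j) ⟨
        B + k * S + j ∸ (B + k * S)     ≡⟨ m+n∸m≡n (B + k * S) j ⟩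
        j                               ∎

    segmentRecordCount-total : G * (G * n !) ≤ 2 * sumℕ (allFin n) segmentRecordCount
    segmentRecordCount-total = begin
      G * (G * n !)
        ≡⟨ sumBelow-const G (G * n !) ⟨
      sumBelow G (λ _ → G * n !)
        ≤⟨ sumBelow-mono G (λ k k<G → sumBelow-harmonic G (n !) (λ j → c (k * S + j)) (λ j → recordCount-bound k j k<G)) ⟩
      sumBelow G (λ k → 2 * sumBelow S (λ j → c (k * S + j)))
        ≡⟨ sumBelow-*ˡ G 2 _ ⟩
      2 * sumBelow G (λ k → sumBelow S (λ j → c (k * S + j)))
        ≡⟨ cong (2 *_) (sumBelow-blocks G S c) ⟨
      2 * sumBelow (G * S) c
        ≤⟨ *-monoʳ-≤ 2 (sumBelow-window B (G * S) n (extend segmentRecordCount) (<⇒≤ F<n)) ⟩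
      2 * sumBelow n (extend segmentRecordCount)
        ≡⟨ cong (2 *_) (sumℕ-allFin n segmentRecordCount) ⟨
      2 * sumℕ (allFin n) segmentRecordCount ∎
      where
      open ≤-Reasoning
      c = λ i → extend segmentRecordCount (B + i)

    queries-bound : ∀ σ → B * segmentRecords σ ≤ weightedDepth σ
    queries-bound σ = begin
      B * segmentRecords σ                ≡⟨ sumBelow-const B _ ⟨
      sumBelow B (λ _ → segmentRecords σ) ≤⟨ sumBelow-mono B query ⟩
      sumBelow B (extend f)               ≤⟨ sumBelow-window 0 B n (extend f) (≤-trans (m≤m+n B (G * S)) (<⇒≤ F<n)) ⟩
      sumBelow n (extend f)               ≡⟨ sumℕ-allFin n f ⟨
      weightedDepth σ                     ∎
      where
      open ≤-Reasoning
      f = λ x → weight (toℕ x) * depth (treap n (prob D) σ) x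
      query : ∀ i → i < B → segmentRecords σ ≤ extend f i
      query i i<B = subst (segmentRecords σ ≤_) (sym (extend-fromℕ< f i<n)) (begin
        segmentRecords σ                               ≤⟨ segmentRecords≤depth σ x x<B ⟩
        depth (treap n (prob D) σ) x
          ≤⟨ m≤n*m _ (levelWeight (toℕ x)) ⦃ m^n≢0 2 (M ∸ levelAt (toℕ x)) ⦄ ⟩
        levelWeight (toℕ x) * depth (treap n (prob D) σ) x
          ≡⟨ cong (_* depth (treap n (prob D) σ) x) (weight-<F (<-≤-trans x<B (m≤m+n B (G * S)))) ⟨
        f x ∎)
        where
        i<n = <-≤-trans i<B (≤-trans (m≤m+n B (G * S)) (<⇒≤ F<n))
        x = Fin.fromℕ< i<n
        x<B : toℕ x < B
        x<B = subst (_< B) (sym (Fin.toℕ-fromℕ< i<n)) i<B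

    totalDepth-bound : B * (G * (G * n !)) ≤ 2 * sumℕ (perms (allFin n)) weightedDepth
    totalDepth-bound = begin
      B * (G * (G * n !))                                  ≤⟨ *-monoʳ-≤ B segmentRecordCount-total ⟩
      B * (2 * sumℕ (allFin n) segmentRecordCount)        ≡⟨ *-comm-middle B 2 _ ⟩
      2 * (B * sumℕ (allFin n) segmentRecordCount)        ≡⟨ cong (λ s → 2 * (B * s)) records-by-ordering ⟩
      2 * (B * sumℕ (perms (allFin n)) segmentRecords)    ≡⟨ cong (2 *_) (sumℕ-*ˡ (perms (allFin n)) B segmentRecords) ⟨
      2 * sumℕ (perms (allFin n)) (λ σ → B * segmentRecords σ) ≤⟨ *-monoʳ-≤ 2 (sumℕ-mono (perms (allFin n)) queries-bound) ⟩
      2 * sumℕ (perms (allFin n)) weightedDepth           ∎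
      where
      open ≤-Reasoning
      *-comm-middle : ∀ a b c → a * (b * c) ≡ b * (a * c)
      *-comm-middle = solve-∀
      records-by-ordering : sumℕ (allFin n) segmentRecordCount ≡ sumℕ (perms (allFin n)) segmentRecords
      records-by-ordering = trans
        (sumℕ-cong (allFin n) (λ y → sym (sumℕ-*ˡ (perms (allFin n)) (𝟙 (inRangeᵇ B F (toℕ y))) _)))
        (sumℕ-comm (allFin n) (perms (allFin n)) _)

    expected-depth-bound : ∀ L → L ≤ 8 * G →
      ℕtoℚ (numOrders n) ℚ.* oneOver 256 ℚ.* ℕtoℚ (L * L) ℚ.≤ totalWeightedDepth n D
    expected-depth-bound L L≤8G = subst₂ ℚ._≤_
      (sym (trans (cong (λ m → ℕtoℚ m ℚ.* oneOver 256 ℚ.* ℕtoℚ (L * L)) numOrders≡)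
                  (ℕtoℚ-*-swap (n !) (oneOver 256) (L * L))))
      (sym totalWeightedDepth-D)
      (*-oneOver-mono (n ! * (L * L)) total 256 (2 ^ M) (begin
        n ! * (L * L) * 2 ^ M                   ≤⟨ *-monoˡ-≤ (2 ^ M) (*-monoʳ-≤ (n !) (*-mono-≤ L≤8G L≤8G)) ⟩
        n ! * (8 * G * (8 * G)) * 2 ^ M         ≡⟨ cong (n ! * (8 * G * (8 * G)) *_) 2^M≡2*B ⟩
        n ! * (8 * G * (8 * G)) * (2 * B)       ≡⟨ regroup (n !) G B ⟩
        128 * (B * (G * (G * n !)))             ≤⟨ *-monoʳ-≤ 128 totalDepth-bound ⟩
        128 * (2 * total)                       ≡⟨ *-assoc 128 2 total ⟨
        256 * total                             ≡⟨ *-comm 256 total ⟩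
        total * 256                             ∎))
      where
      open ≤-Reasoning
      total = sumℕ (perms (allFin n)) weightedDepth
      regroup : ∀ a g b → a * (8 * g * (8 * g)) * (2 * b) ≡ 128 * (b * (g * (g * a)))
      regroup = solve-∀
      numOrders≡ : numOrders n ≡ n !
      numOrders≡ = trans (length-perms (allFin n)) (cong _! (length-tabulate {n = n} (λ z → z)))

  2^⌊log₂n⌋≤n : ∀ n → 1 ≤ n → 2 ^ ⌊log₂ n ⌋ ≤ n
  2^⌊log₂n⌋≤n = <-rec _ step
    where
    step : ∀ n → (∀ {m} → m < n → 1 ≤ m → 2 ^ ⌊log₂ m ⌋ ≤ m) → 1 ≤ n → 2 ^ ⌊log₂ n ⌋ ≤ n
    step (suc zero)    _   _ = ≤-refl
    step (suc (suc m)) rec _ = begin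
      2 ^ ⌊log₂ n ⌋        ≡⟨ cong (2 ^_) log≡ ⟩
      2 * 2 ^ ⌊log₂ h ⌋    ≤⟨ *-monoʳ-≤ 2 (rec (⌊n/2⌋<n (suc m)) (s≤s z≤n)) ⟩
      h + (h + 0)          ≤⟨ +-monoʳ-≤ h (≤-trans (≤-reflexive (+-identityʳ h)) (⌊n/2⌋≤⌈n/2⌉ n)) ⟩
      h + ⌈ n /2⌉          ≡⟨ ⌊n/2⌋+⌈n/2⌉≡n n ⟩
      n                    ∎
      where
      open ≤-Reasoning
      n = suc (suc m)
      h = ⌊ n /2⌋
      log≡ : ⌊log₂ n ⌋ ≡ suc ⌊log₂ h ⌋
      log≡ = trans (sym (m+[n∸m]≡n (⌊log₂⌋-mono-≤ {2} {n} (s≤s (s≤s z≤n)))))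
                   (cong suc (sym (⌊log₂⌊n/2⌋⌋≡⌊log₂n⌋∸1 n)))

  logParameter : ℕ → ℕ
  logParameter n = (⌊log₂ n ⌋ ∸ 2) / 3

  module _ {n : ℕ} (n≥32 : 32 ≤ n) where

    private
      L = ⌊log₂ n ⌋
      G = logParameter n
      L≥5 : 5 ≤ L
      L≥5 = ⌊log₂⌋-mono-≤ n≥32

    logParameter≥1 : 1 ≤ logParameter n
    logParameter≥1 = m≥n⇒m/n>0 (∸-monoˡ-≤ 2 L≥5)

    fillerPosition<n : fillerPosition (logParameter n) < n
    fillerPosition<n = begin-strict
      fillerPosition G  <⟨ fillerPosition<2^[3G+2] G logParameter≥1 ⟩
      2 ^ (3 * G + 2)   ≤⟨ ^-monoʳ-≤ 2 3G+2≤L ⟩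
      2 ^ L             ≤⟨ 2^⌊log₂n⌋≤n n (≤-trans (s≤s z≤n) n≥32) ⟩
      n                 ∎
      where
      open ≤-Reasoning
      3G+2≤L : 3 * G + 2 ≤ L
      3G+2≤L = subst₂ _≤_ (cong (_+ 2) (*-comm G 3)) (m∸n+n≡m (≤-trans (s≤s (s≤s z≤n)) L≥5))
        (+-monoˡ-≤ 2 (m/n*n≤m (L ∸ 2) 3))

    ⌊log₂n⌋≤8*logParameter : ⌊log₂ n ⌋ ≤ 8 * logParameter n
    ⌊log₂n⌋≤8*logParameter = begin
      L                             ≤⟨ m≤n+m∸n L 2 ⟩
      2 + (L ∸ 2)                   ≡⟨ cong (2 +_) (m≡m%n+[m/n]*n (L ∸ 2) 3) ⟩
      2 + ((L ∸ 2) % 3 + G * 3)     ≤⟨ +-monoʳ-≤ 2 (+-monoˡ-≤ (G * 3) (≤-pred (m%n<n (L ∸ 2) 3))) ⟩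
      4 + G * 3                     ≤⟨ +-monoˡ-≤ (G * 3) (*-monoʳ-≤ 4 logParameter≥1) ⟩
      4 * G + G * 3                 ≤⟨ m≤m+n (4 * G + G * 3) G ⟩
      4 * G + G * 3 + G             ≡⟨ seven+1 G ⟩
      8 * G                         ∎
      where
      open ≤-Reasoning
      seven+1 : ∀ G → 4 * G + G * 3 + G ≡ 8 * G
      seven+1 = solve-∀

open import Defs
open import Data.Nat using (ℕ; _≥_)
open import Data.Nat.Logarithm using (⌊log₂_⌋)
open import Data.Product using (Σ; _×_; _,_)
open import Data.Rational using (ℚ; 0ℚ; _<_; _≤_; _*_)
open TreapDepth using (oneOver; oneOver-positive; logParameter; logParameter≥1; fillerPosition<n; ⌊log₂n⌋≤8*logParameter; module HardInstance)

mainTheorem7 : Σ ℚ λ c → (0ℚ < c) × (Σ ℕ λ N → (n : ℕ) → n ≥ N →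
    Σ (Distribution n) λ D →
      ℕtoℚ (numOrders n) * c * ℕtoℚ (⌊log₂ n ⌋ Data.Nat.* ⌊log₂ n ⌋) ≤ totalWeightedDepth n D)
mainTheorem7 = oneOver 256 , oneOver-positive 256 , 32 , λ n n≥32 →
  let open HardInstance (logParameter n) n (logParameter≥1 n≥32) (fillerPosition<n n≥32)
  in D , expected-depth-bound ⌊log₂ n ⌋ (⌊log₂n⌋≤8*logParameter n≥32)
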